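{- Let $q=p^s$ with $p$ an odd prime and $s\ge1$, let $n\geq 1$, let $a_1,\dots,a_n\in\mathbb{F}_q^*$, and let $$N^*(n,0)=\#\{(x_1,\dots,x_n)\in(\mathbb{F}_q^*)^n\mid a_1x_1^2+\cdots+a_nx_n^2=0\}.$$ Let $\chi$ be the quadratic character of $\mathbb{F}_q^*$ and $m=\#\{1\le i\le n\mid \chi(a_i)=1\}$. (1) If either $p\equiv1\pmod4$, or $p\equiv3\pmod4$ and $s$ is even, then $$N^*(n,0)=\frac{(q-1)^n}{q}+(-1)^n\frac{q-1}{2q}\Big[(1-\sqrt q)^{m}(1+\sqrt q)^{n-m}+(1+\sqrt q)^{m}(1-\sqrt q)^{n-m}\Big].$$ (2) If $p\equiv3\pmod4$ and $s$ is odd, then $$N^*(n,0)=\frac{(q-1)^n}{q}+(-1)^n\frac{q-1}{2q}\Big[(1-\sqrt q i)^{m}(1+\sqrt q i)^{n-m}+(1+\sqrt q i)^{m}(1-\sqrt q i)^{n-m}\Big],$$ where $i=\sqrt{ -1}$. -}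

module Defs where

open import Level using (_⊔_)
open import Algebra.Bundles using (CommutativeRing)
open import Data.Nat as ℕ using (ℕ; zero; suc)
open import Data.Fin using (Fin; zero; suc)
open import Data.Fin.Properties using (any?; all?)
open import Data.Vec using (Vec; []; _∷_; lookup)
open import Data.List as List using (List; []; _∷_; length; filter; concatMap; allFin)
open import Data.Integer as ℤ using (ℤ; +_)
open import Data.Product using (∃; _,_; _×_)
open import Relation.Nullary using (¬_; Dec; yes; no)
open import Relation.Nullary.Decidable using (_×-dec_; ¬?)
open import Relation.Binary using () renaming (Decidable to Decidable₂)
open import Relation.Unary using (Decidable)
open import Relation.Binary.PropositionalEquality using (_≡_)

record IsFiniteField {c ℓ} (F : CommutativeRing c ℓ) (q : ℕ) : Set (c ⊔ ℓ) where
  open CommutativeRing F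
  field
    1≉0             : ¬ (1# ≈ 0#)
    inverse         : ∀ x → ¬ (x ≈ 0#) → ∃ λ y → x * y ≈ 1#
    _≟_             : Decidable₂ _≈_
    enum            : Fin q → Carrier
    enum-injective  : ∀ i j → enum i ≈ enum j → i ≡ j
    enum-surjective : ∀ x → ∃ λ i → enum i ≈ x

module FiniteFieldNotions {c ℓ} (F : CommutativeRing c ℓ) {q : ℕ} (FF : IsFiniteField F q) where
  open CommutativeRing F using (Carrier; _≈_; _+_; _*_; 0#; 1#; trans; *-cong)
  open IsFiniteField FF

  ∑ : ∀ {n} → (Fin n → Carrier) → Carrier
  ∑ {zero}  f = 0#
  ∑ {suc n} f = f zero + ∑ (λ i → f (suc i))

  IsSquare : Carrier → Set (c ⊔ ℓ)
  IsSquare x = ∃ λ y → y * y ≈ x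

  isSquare? : ∀ x → Dec (IsSquare x)
  isSquare? x with any? (λ i → (enum i * enum i) ≟ x)
  ... | yes (i , p) = yes (enum i , p)
  ... | no ¬p = no λ { (y , yy≈x) →
          let (i , ei≈y) = enum-surjective y
          in ¬p (i , trans (*-cong ei≈y ei≈y) yy≈x) }

  -- all n-tuples of elements of F (represented by their indices in Fin q)
  allTuples : ∀ n → List (Vec (Fin q) n)
  allTuples zero    = [] ∷ []
  allTuples (suc n) = concatMap (λ i → List.map (i ∷_) (allTuples n)) (allFin q)

  Solution : ∀ {n} → (Fin n → Carrier) → Vec (Fin q) n → Set ℓ
  Solution {n} a v =
    (∀ i → ¬ (enum (lookup v i) ≈ 0#)) ×
    (∑ (λ i → a i * (enum (lookup v i) * enum (lookup v i))) ≈ 0#)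

  solution? : ∀ {n} (a : Fin n → Carrier) → Decidable (Solution a)
  solution? a v = all? (λ i → ¬? (enum (lookup v i) ≟ 0#)) ×-dec (_ ≟ 0#)

  Nstar : ∀ n → (Fin n → Carrier) → ℕ
  Nstar n a = length (filter (solution? a) (allTuples n))

  -- m = #{ i | χ(a_i) = 1 } = #{ i | a_i is a (nonzero) square }
  numSquares : ∀ n → (Fin n → Carrier) → ℕ
  numSquares n a = length (filter (λ i → isSquare? (a i)) (allFin n))

-- The ring ℤ[√d] = ℤ[X]/(X² − d): re + im·√d, with formal arithmetic.
-- With d = q this models 1 ± √q; with d = −q it models 1 ± √q·i.

record ℤ√ : Set where
  constructor _+_√
  field
    re : ℤ
    im : ℤ

module ℤ√Ops (d : ℤ) where
  infixl 6 _⊕_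
  infixl 7 _⊗_
  _⊕_ : ℤ√ → ℤ√ → ℤ√
  (a + b √) ⊕ (c + e √) = (a ℤ.+ c) + (b ℤ.+ e) √
  _⊗_ : ℤ√ → ℤ√ → ℤ√
  (a + b √) ⊗ (c + e √) = (a ℤ.* c ℤ.+ d ℤ.* (b ℤ.* e)) + (a ℤ.* e ℤ.+ b ℤ.* c) √
  _^^_ : ℤ√ → ℕ → ℤ√
  x ^^ zero  = (+ 1) + (+ 0) √
  x ^^ suc k = x ⊗ (x ^^ k)
  const : ℤ → ℤ√
  const z = z + (+ 0) √
  onePlusRoot oneMinusRoot : ℤ√
  onePlusRoot  = (+ 1) + (+ 1) √
  oneMinusRoot = (+ 1) + (ℤ.- (+ 1)) √

  bracket : ℕ → ℕ → ℤ√
  bracket n m = (oneMinusRoot ^^ m) ⊗ (onePlusRoot ^^ (n ℕ.∸ m))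
              ⊕ (onePlusRoot ^^ m) ⊗ (oneMinusRoot ^^ (n ℕ.∸ m))

  FormulaHolds : (q n m N : ℕ) → Set
  FormulaHolds q n m N =
    const (+ (2 ℕ.* q ℕ.* N))
      ≡ const (+ 2 ℤ.* (+ (q ℕ.∸ 1)) ℤ.^ n)
        ⊕ const ((ℤ.- (+ 1)) ℤ.^ n ℤ.* (+ (q ℕ.∸ 1))) ⊗ bracket n m

module Submission where

-- Theorem 3.5: for a finite field 𝔽 of odd order q, nonzero a₁, …, aₙ, m of
-- them squares, 2q·N*(n,0) = 2(q-1)ⁿ + (-1)ⁿ(q-1)·[(1-√d)ᵐ(1+√d)ⁿ⁻ᵐ + (1+√d)ᵐ(1-√d)ⁿ⁻ᵐ]
-- in ℤ[√d], with d = χ(-1)·q, i.e. d = q for q ≡ 1 and d = -q for q ≡ 3 (mod 4).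
--
-- Let N(n,a,c) count the solutions of Σ aᵢxᵢ² = c with all xᵢ ≠ 0, and
-- U = ∏ᵢ (1 - χ(aᵢ)√d) = u + v√d.  By induction on n, for every c,
--   q·N(n,a,c) = (q-1)ⁿ + (-1)ⁿ((q·[c=0] - 1)·u + q·χ(c)·v):
-- fixing x₁ = x ∈ 𝔽* leaves N(n-1, a′, c - a₁x²), and the resulting sums over 𝔽*
-- of [c - bx² = 0] and χ(c - bx²) follow from "t has 1 + χ(t) square roots" and
-- the Jacobsthal-type sum Σₓ χ(c - bx²) = -χ(-b).  At c = 0 this is the theorem,
-- since U = (1-√d)ᵐ(1+√d)ⁿ⁻ᵐ and the bracket is U + Ū = 2u.

open import Defs
open import Level using (_⊔_)
open import Algebra.Bundles using (AbelianGroup; CommutativeRing)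
open import Data.Bool using (Bool; true; false; if_then_else_)
open import Data.Empty using (⊥-elim)
open import Data.Fin as Fin using (Fin)
import Data.Fin.Properties as FinP
open import Data.Fin.Permutation using (permutation)
open import Data.Integer as ℤ using (ℤ; +_; -_; _+_; _*_; _-_)
import Data.Integer.Properties as ℤP
open import Data.Integer.Tactic.RingSolver using (solve-∀)
open import Data.List as List using (List; []; _∷_; length; filter)
import Data.List.Properties as ListP
open import Data.List.Relation.Unary.All using (universal)
open import Data.List.Relation.Unary.All.Properties using (map⁺)
open import Data.Maybe.Base using (Maybe; just; nothing)
open import Data.Nat as ℕ using (ℕ; zero; suc; _∸_; _^_; _%_; _/_; _≤_)
import Data.Nat.Properties as ℕP
open import Data.Nat.DivMod using (%-distribˡ-*; m%n%n≡m%n; m≡m%n+[m/n]*n)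
open import Data.Nat.Primality using (Prime)
open import Data.Product using (∃; _×_; _,_; proj₁; proj₂)
open import Data.Sum using (_⊎_; inj₁; inj₂; [_,_]′)
open import Data.Vec using (Vec; []; _∷_; lookup)
open import Relation.Nullary using (¬_; Dec; yes; no; does)
open import Relation.Nullary.Decidable using (_×-dec_; ¬?; toSum; dec-true; dec-false)
open import Relation.Binary.Definitions using (tri<; tri≈; tri>)
open import Relation.Binary.PropositionalEquality
  using (_≡_; _≢_; refl; sym; trans; cong; cong₂; subst; module ≡-Reasoning)
import Relation.Binary.Reasoning.Setoid as SetoidReasoning
open import Algebra.Properties.Semiring.Sum ℤP.+-*-semiring
  using (sum; ∑-distrib-+; ∑-comm; ∑-permute; *-distribˡ-sum; sum-cong-≗)
import Algebra.Properties.Semiring.Sum ℕP.+-*-semiring as ℕΣ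
open import Algebra.Properties.Group (AbelianGroup.group ℤP.+-0-abelianGroup)
  using () renaming (∙-cancelˡ to +-cancelˡ; ∙-cancelʳ to +-cancelʳ)

𝟙 : ∀ {a} {A : Set a} → Dec A → ℤ
𝟙 (yes _) = + 1
𝟙 (no _)  = + 0

𝟙-yes : ∀ {a} {A : Set a} (d : Dec A) → A → 𝟙 d ≡ + 1
𝟙-yes (yes _) _ = refl
𝟙-yes (no ¬a) a = ⊥-elim (¬a a)

𝟙-no : ∀ {a} {A : Set a} (d : Dec A) → ¬ A → 𝟙 d ≡ + 0
𝟙-no (yes a) ¬a = ⊥-elim (¬a a)
𝟙-no (no _)  _  = refl

sum-scale : ∀ {n} k (f : Fin n → ℤ) → sum (λ i → k * f i) ≡ k * sum f
sum-scale k f = sym (*-distribˡ-sum k f)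

sum-neg : ∀ {n} (f : Fin n → ℤ) → sum (λ i → - f i) ≡ - sum f
sum-neg f = begin
  sum (λ i → - f i)          ≡⟨ sum-cong-≗ (λ i → sym (ℤP.-1*i≡-i (f i))) ⟩
  sum (λ i → - + 1 * f i)    ≡⟨ sum-scale (- + 1) f ⟩
  - + 1 * sum f              ≡⟨ ℤP.-1*i≡-i (sum f) ⟩
  - sum f                    ∎
  where open ≡-Reasoning

sum-minus : ∀ {n} (f g : Fin n → ℤ) → sum (λ i → f i - g i) ≡ sum f - sum g
sum-minus f g = trans (∑-distrib-+ f (λ i → - g i)) (cong (λ z → sum f + z) (sum-neg g))

sum-const : ∀ n k → sum {n} (λ _ → k) ≡ + n * k
sum-const zero    k = refl
sum-const (suc n) k = begin
  k + sum {n} (λ _ → k)  ≡⟨ cong (λ z → k + z) (sum-const n k) ⟩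
  k + + n * k            ≡⟨ factor-out k (+ n) ⟩
  (+ 1 + + n) * k        ≡⟨ cong (_* k) (sym (ℤP.pos-+ 1 n)) ⟩
  + suc n * k            ∎
  where
  open ≡-Reasoning
  factor-out : ∀ k m → k + m * k ≡ (+ 1 + m) * k
  factor-out = solve-∀

sum-zero : ∀ {n} {f : Fin n → ℤ} → (∀ i → f i ≡ + 0) → sum f ≡ + 0
sum-zero {n} f≡0 = trans (sum-cong-≗ f≡0) (trans (sum-const n (+ 0)) (ℤP.*-zeroʳ (+ n)))

sum-single : ∀ {n} (f : Fin n → ℤ) (i₀ : Fin n) → (∀ j → j ≢ i₀ → f j ≡ + 0) → sum f ≡ f i₀
sum-single {suc n} f Fin.zero off = begin
  f Fin.zero + sum (λ j → f (Fin.suc j)) ≡⟨ cong (λ z → f Fin.zero + z) (sum-zero (λ j → off (Fin.suc j) (λ ()))) ⟩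
  f Fin.zero + + 0                       ≡⟨ ℤP.+-identityʳ _ ⟩
  f Fin.zero                             ∎
  where open ≡-Reasoning
sum-single {suc n} f (Fin.suc i₀) off = begin
  f Fin.zero + sum (λ j → f (Fin.suc j)) ≡⟨ cong (_+ sum (λ j → f (Fin.suc j))) (off Fin.zero (λ ())) ⟩
  + 0 + sum (λ j → f (Fin.suc j))        ≡⟨ ℤP.+-identityˡ _ ⟩
  sum (λ j → f (Fin.suc j))              ≡⟨ sum-single (λ j → f (Fin.suc j)) i₀ (λ j j≢i₀ → off (Fin.suc j) (λ e → j≢i₀ (FinP.suc-injective e))) ⟩
  f (Fin.suc i₀)                         ∎
  where open ≡-Reasoning

sum-of-naturals : ∀ {n} (f : Fin n → ℕ) → sum (λ i → + f i) ≡ + ℕΣ.sum f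
sum-of-naturals {zero}  f = refl
sum-of-naturals {suc n} f = trans (cong (λ z → + f Fin.zero + z) (sum-of-naturals (λ i → f (Fin.suc i))))
                          (sym (ℤP.pos-+ (f Fin.zero) _))

sum-nonneg-zero : ∀ {n} (f : Fin n → ℕ) → sum (λ i → + f i) ≡ + 0 → ∀ i → f i ≡ 0
sum-nonneg-zero f total = ℕ-sum-zero f (ℤP.+-injective (trans (sym (sum-of-naturals f)) total))
  where
  ℕ-sum-zero : ∀ {n} (f : Fin n → ℕ) → ℕΣ.sum f ≡ 0 → ∀ i → f i ≡ 0
  ℕ-sum-zero f s≡0 Fin.zero    = ℕP.m+n≡0⇒m≡0 _ s≡0
  ℕ-sum-zero f s≡0 (Fin.suc i) = ℕ-sum-zero (λ j → f (Fin.suc j)) (ℕP.m+n≡0⇒n≡0 (f Fin.zero) s≡0) i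

-- Pairing off the orbits of an involution σ of Fin n: for a σ-invariant
-- weight w, every 2-cycle {i, σ i} contributes 2·w i to Σ w, so adding the
-- weights of the fixed points once more yields an even number.
involution-parity : ∀ {n} (σ : Fin n → Fin n) → (∀ i → σ (σ i) ≡ i)
  → (w : Fin n → ℤ) → (∀ i → w (σ i) ≡ w i)
  → ∃ λ k → sum w + sum (λ i → 𝟙 (σ i FinP.≟ i) * w i) ≡ k + k
involution-parity {n} σ σσ w wσ = sum half , sym pairing
  where
  half : Fin n → ℤ
  half i = w i * (𝟙 (i FinP.<? σ i) + 𝟙 (σ i FinP.≟ i))

  orbit : ∀ i → half i + half (σ i) ≡ w i + 𝟙 (σ i FinP.≟ i) * w i
  orbit i with FinP.<-cmp i (σ i)
  ... | tri< i<σi i≢σi σi≮i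
    rewrite 𝟙-yes (i FinP.<? σ i) i<σi | 𝟙-no (σ i FinP.≟ i) (λ e → i≢σi (sym e))
          | 𝟙-no (σ i FinP.<? σ (σ i)) (λ lt → σi≮i (subst (σ i Fin.<_) (σσ i) lt))
          | 𝟙-no (σ (σ i) FinP.≟ σ i) (λ e → i≢σi (trans (sym (σσ i)) e)) | wσ i = two-cycle (w i)
    where
    two-cycle : ∀ x → x * (+ 1 + + 0) + x * (+ 0 + + 0) ≡ x + + 0 * x
    two-cycle = solve-∀
  ... | tri≈ i≮σi i≡σi σi≮i
    rewrite 𝟙-no (i FinP.<? σ i) i≮σi | 𝟙-yes (σ i FinP.≟ i) (sym i≡σi)
          | 𝟙-no (σ i FinP.<? σ (σ i)) (λ lt → σi≮i (subst (σ i Fin.<_) (σσ i) lt))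
          | 𝟙-yes (σ (σ i) FinP.≟ σ i) (trans (σσ i) i≡σi) | wσ i = fixed (w i)
    where
    fixed : ∀ x → x * (+ 0 + + 1) + x * (+ 0 + + 1) ≡ x + + 1 * x
    fixed = solve-∀
  ... | tri> i≮σi i≢σi σi<i
    rewrite 𝟙-no (i FinP.<? σ i) i≮σi | 𝟙-no (σ i FinP.≟ i) (λ e → i≢σi (sym e))
          | 𝟙-yes (σ i FinP.<? σ (σ i)) (subst (σ i Fin.<_) (sym (σσ i)) σi<i)
          | 𝟙-no (σ (σ i) FinP.≟ σ i) (λ e → i≢σi (trans (sym (σσ i)) e)) | wσ i = two-cycle (w i)
    where
    two-cycle : ∀ x → x * (+ 0 + + 0) + x * (+ 1 + + 0) ≡ x + + 0 * x
    two-cycle = solve-∀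

  pairing : sum half + sum half ≡ sum w + sum (λ i → 𝟙 (σ i FinP.≟ i) * w i)
  pairing = begin
    sum half + sum half                          ≡⟨ cong (λ z → sum half + z) (∑-permute half (permutation σ σ σσ σσ)) ⟩
    sum half + sum (λ i → half (σ i))            ≡⟨ sym (∑-distrib-+ half (λ i → half (σ i))) ⟩
    sum (λ i → half i + half (σ i))              ≡⟨ sum-cong-≗ orbit ⟩
    sum (λ i → w i + 𝟙 (σ i FinP.≟ i) * w i)     ≡⟨ ∑-distrib-+ w _ ⟩
    sum w + sum (λ i → 𝟙 (σ i FinP.≟ i) * w i)   ∎
    where open ≡-Reasoning

odd≢even : ∀ a b → a + a + + 1 ≢ b + b
odd≢even a b eq = twice≢1 (b - a) (begin
  (b - a) + (b - a)          ≡⟨ regroup a b ⟩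
  (b + b) - (a + a)          ≡⟨ cong (_- (a + a)) (sym eq) ⟩
  (a + a + + 1) - (a + a)    ≡⟨ cancel a ⟩
  + 1                        ∎)
  where
  open ≡-Reasoning
  twice≢1 : ∀ x → x + x ≢ + 1
  twice≢1 (+ zero)    ()
  twice≢1 (+ suc k)   e = ℕP.m+1+n≢0 k (ℕP.suc-injective (ℤP.+-injective e))
  twice≢1 ℤ.-[1+ k ] ()
  regroup : ∀ a b → (b - a) + (b - a) ≡ (b + b) - (a + a)
  regroup = solve-∀
  cancel : ∀ a → (a + a + + 1) - (a + a) ≡ + 1
  cancel = solve-∀

halve : ∀ a b → a + a ≡ b + b → a ≡ b
halve a b eq = ℤP.*-cancelˡ-≡ (+ 2) a b (trans (double a) (trans eq (sym (double b))))
  where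
  double : ∀ x → + 2 * x ≡ x + x
  double = solve-∀

-- Every commutative ring R receives the canonical map ℤ → R, i ↦ i·1#.  It
-- is a ring homomorphism, which instantiates the library's ring solver with
-- integer coefficients for R.
module IntegerCoefficients {c ℓ} (R : CommutativeRing c ℓ) where
  open CommutativeRing R renaming (_+_ to _⊕_; _*_ to _⊗_; -_ to ⊖_; refl to ≈-refl; sym to ≈-sym; trans to ≈-trans)
  open import Relation.Binary.Reasoning.Setoid setoid
  open import Algebra.Properties.Ring ring using (-1*x≈-x; -‿distribˡ-*)
  open import Algebra.Properties.AbelianGroup +-abelianGroup using (⁻¹-∙-comm)
  open import Algebra.Properties.Group +-group using (ε⁻¹≈ε; ⁻¹-involutive)
  open import Algebra.Properties.Semiring.Mult.TCOptimised semiring using (×-homo-+; ×1-homo-*; 1+×) renaming (_×_ to _×ᵣ_)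
  import Algebra.Solver.CommutativeMonoid
  import Algebra.Solver.Ring.AlmostCommutativeRing as ACR
  import Data.Sign.Base as Sign
  private
    module +-Solver = Algebra.Solver.CommutativeMonoid +-commutativeMonoid
    module *-Solver = Algebra.Solver.CommutativeMonoid *-commutativeMonoid

  ⟦_⟧ : ℤ → Carrier
  ⟦ + n ⟧      = n ×ᵣ 1#
  ⟦ ℤ.-[1+ n ] ⟧ = ⊖ (suc n ×ᵣ 1#)

  private
    interchange : ∀ a b c d → (a ⊕ b) ⊕ (c ⊕ d) ≈ (a ⊕ c) ⊕ (b ⊕ d)
    interchange = +-Solver.solve 4 (λ a b c d → (a +-Solver.⊕ b) +-Solver.⊕ (c +-Solver.⊕ d)
                                        +-Solver.⊜ (a +-Solver.⊕ c) +-Solver.⊕ (b +-Solver.⊕ d)) ≈-refl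

    ⊖-homo : ∀ m n → ⟦ m ℤ.⊖ n ⟧ ≈ m ×ᵣ 1# ⊕ ⊖ (n ×ᵣ 1#)
    ⊖-homo m       zero    = ≈-sym (≈-trans (+-congˡ ε⁻¹≈ε) (+-identityʳ _))
    ⊖-homo zero    (suc n) = ≈-sym (+-identityˡ _)
    ⊖-homo (suc m) (suc n) = begin
      ⟦ suc m ℤ.⊖ suc n ⟧                       ≡⟨ cong ⟦_⟧ (ℤP.[1+m]⊖[1+n]≡m⊖n m n) ⟩
      ⟦ m ℤ.⊖ n ⟧                               ≈⟨ ⊖-homo m n ⟩
      m ×ᵣ 1# ⊕ ⊖ (n ×ᵣ 1#)                       ≈⟨ ≈-sym (+-identityˡ _) ⟩
      0# ⊕ (m ×ᵣ 1# ⊕ ⊖ (n ×ᵣ 1#))                ≈⟨ +-congʳ (≈-sym (-‿inverseʳ 1#)) ⟩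
      (1# ⊕ ⊖ 1#) ⊕ (m ×ᵣ 1# ⊕ ⊖ (n ×ᵣ 1#))       ≈⟨ interchange 1# (⊖ 1#) (m ×ᵣ 1#) (⊖ (n ×ᵣ 1#)) ⟩
      (1# ⊕ m ×ᵣ 1#) ⊕ (⊖ 1# ⊕ ⊖ (n ×ᵣ 1#))       ≈⟨ +-congˡ (⁻¹-∙-comm 1# (n ×ᵣ 1#)) ⟩
      (1# ⊕ m ×ᵣ 1#) ⊕ ⊖ (1# ⊕ n ×ᵣ 1#)           ≈⟨ ≈-sym (+-cong (1+× m 1#) (-‿cong (1+× n 1#))) ⟩
      suc m ×ᵣ 1# ⊕ ⊖ (suc n ×ᵣ 1#)               ∎

    +-homo : ∀ i j → ⟦ i ℤ.+ j ⟧ ≈ ⟦ i ⟧ ⊕ ⟦ j ⟧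
    +-homo ℤ.-[1+ m ] ℤ.-[1+ n ] = begin
      ⊖ (suc (suc (m ℕ.+ n)) ×ᵣ 1#)          ≡⟨ cong (λ k → ⊖ (suc k ×ᵣ 1#)) (sym (ℕP.+-suc m n)) ⟩
      ⊖ ((suc m ℕ.+ suc n) ×ᵣ 1#)            ≈⟨ -‿cong (×-homo-+ 1# (suc m) (suc n)) ⟩
      ⊖ (suc m ×ᵣ 1# ⊕ suc n ×ᵣ 1#)           ≈⟨ ≈-sym (⁻¹-∙-comm _ _) ⟩
      ⊖ (suc m ×ᵣ 1#) ⊕ ⊖ (suc n ×ᵣ 1#)       ∎
    +-homo ℤ.-[1+ m ] (+ n)      = ≈-trans (⊖-homo n (suc m)) (+-comm _ _)
    +-homo (+ m)      ℤ.-[1+ n ] = ⊖-homo m (suc n)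
    +-homo (+ m)      (+ n)      = ×-homo-+ 1# m n

    -- multiplicativity, through the decomposition i = sign(i)·|i|
    sign : Sign.Sign → Carrier
    sign Sign.+ = 1#
    sign Sign.- = ⊖ 1#

    sign-homo : ∀ s t → sign (s Sign.* t) ≈ sign s ⊗ sign t
    sign-homo Sign.- Sign.- = ≈-sym (begin
      ⊖ 1# ⊗ ⊖ 1#    ≈⟨ ≈-sym (-‿distribˡ-* 1# (⊖ 1#)) ⟩
      ⊖ (1# ⊗ ⊖ 1#)  ≈⟨ -‿cong (*-identityˡ _) ⟩
      ⊖ ⊖ 1#         ≈⟨ ⁻¹-involutive 1# ⟩
      1#             ∎)
    sign-homo Sign.- Sign.+ = ≈-sym (*-identityʳ _)
    sign-homo Sign.+ _      = ≈-sym (*-identityˡ _)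

    ◃-homo : ∀ s n → ⟦ s ℤ.◃ n ⟧ ≈ sign s ⊗ (n ×ᵣ 1#)
    ◃-homo s      zero    = ≈-sym (zeroʳ _)
    ◃-homo Sign.- (suc n) = ≈-sym (-1*x≈-x _)
    ◃-homo Sign.+ (suc n) = ≈-sym (*-identityˡ _)

    sign-abs : ∀ i → ⟦ i ⟧ ≈ sign (ℤ.sign i) ⊗ (ℤ.∣ i ∣ ×ᵣ 1#)
    sign-abs i = ≈-trans (reflexive (cong ⟦_⟧ (sym (ℤP.◃-inverse i)))) (◃-homo (ℤ.sign i) ℤ.∣ i ∣)

    *-homo : ∀ i j → ⟦ i ℤ.* j ⟧ ≈ ⟦ i ⟧ ⊗ ⟦ j ⟧
    *-homo i j = begin
      ⟦ i ℤ.* j ⟧                                      ≈⟨ ◃-homo (ℤ.sign i Sign.* ℤ.sign j) (ℤ.∣ i ∣ ℕ.* ℤ.∣ j ∣) ⟩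
      sign (ℤ.sign i Sign.* ℤ.sign j) ⊗ ((ℤ.∣ i ∣ ℕ.* ℤ.∣ j ∣) ×ᵣ 1#)
                                                       ≈⟨ *-cong (sign-homo (ℤ.sign i) (ℤ.sign j)) (×1-homo-* ℤ.∣ i ∣ ℤ.∣ j ∣) ⟩
      (sign (ℤ.sign i) ⊗ sign (ℤ.sign j)) ⊗ ((ℤ.∣ i ∣ ×ᵣ 1#) ⊗ (ℤ.∣ j ∣ ×ᵣ 1#))
                                                       ≈⟨ *-Solver.solve 4 (λ a b c d → (a *-Solver.⊕ b) *-Solver.⊕ (c *-Solver.⊕ d)
                                                            *-Solver.⊜ (a *-Solver.⊕ c) *-Solver.⊕ (b *-Solver.⊕ d)) ≈-refl _ _ _ _ ⟩
      (sign (ℤ.sign i) ⊗ (ℤ.∣ i ∣ ×ᵣ 1#)) ⊗ (sign (ℤ.sign j) ⊗ (ℤ.∣ j ∣ ×ᵣ 1#))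
                                                       ≈⟨ ≈-sym (*-cong (sign-abs i) (sign-abs j)) ⟩
      ⟦ i ⟧ ⊗ ⟦ j ⟧                                    ∎

    neg-homo : ∀ i → ⟦ ℤ.- i ⟧ ≈ ⊖ ⟦ i ⟧
    neg-homo ℤ.-[1+ n ]    = ≈-sym (⁻¹-involutive _)
    neg-homo (+ zero)      = ≈-sym ε⁻¹≈ε
    neg-homo (+ suc n)     = ≈-refl

    homomorphism : ℤ.+-*-rawRing ACR.-Raw-AlmostCommutative⟶ ACR.fromCommutativeRing R
    homomorphism = record
      { ⟦_⟧ = ⟦_⟧ ; +-homo = +-homo ; *-homo = *-homo ; -‿homo = neg-homo
      ; 0-homo = ≈-refl ; 1-homo = ≈-refl }

    coefficient-equality : (i j : ℤ) → Maybe (⟦ i ⟧ ≈ ⟦ j ⟧)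
    coefficient-equality i j with i ℤ.≟ j
    ... | yes refl = just ≈-refl
    ... | no _     = nothing

  open import Algebra.Solver.Ring ℤ.+-*-rawRing (ACR.fromCommutativeRing R) homomorphism coefficient-equality public
    using (solve; _:=_; _:+_; _:*_; :-_; _:-_; con)

Characteristic≢2 : ∀ {c ℓ} → CommutativeRing c ℓ → Set ℓ
Characteristic≢2 F = ¬ (1# ⊹ 1# ≈ 0#)
  where open CommutativeRing F using (_≈_; 1#; 0#) renaming (_+_ to _⊹_)

module FieldFacts {c ℓ} (F : CommutativeRing c ℓ) {q : ℕ} (FF : IsFiniteField F q) where
  open CommutativeRing F public
    renaming (Carrier to 𝔽; _+_ to _⊹_; _*_ to _·_; -_ to ~_; _-_ to _⊟_;
              refl to ≈-refl; sym to ≈-sym; trans to ≈-trans)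
  open IsFiniteField FF public
  open FiniteFieldNotions F FF public
  open IntegerCoefficients F public
  module ≈-Reasoning = SetoidReasoning setoid

  -- The inverse, extended by 0⁻¹ = 0.
  _⁻¹ : 𝔽 → 𝔽
  x ⁻¹ with x ≟ 0#
  ... | yes _   = 0#
  ... | no x≉0 = proj₁ (inverse x x≉0)

  ⁻¹-inverseʳ : ∀ {x} → x ≉ 0# → x · x ⁻¹ ≈ 1#
  ⁻¹-inverseʳ {x} x≉0 with x ≟ 0#
  ... | yes x≈0 = ⊥-elim (x≉0 x≈0)
  ... | no x≉0′ = proj₂ (inverse x x≉0′)

  ⁻¹-inverseˡ : ∀ {x} → x ≉ 0# → x ⁻¹ · x ≈ 1#
  ⁻¹-inverseˡ x≉0 = ≈-trans (*-comm _ _) (⁻¹-inverseʳ x≉0)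

  ⁻¹-zero : ∀ {x} → x ≈ 0# → x ⁻¹ ≈ 0#
  ⁻¹-zero {x} x≈0 with x ≟ 0#
  ... | yes _    = ≈-refl
  ... | no x≉0 = ⊥-elim (x≉0 x≈0)

  inverse-unique : ∀ {a b b′} → a · b ≈ 1# → a · b′ ≈ 1# → b ≈ b′
  inverse-unique {a} {b} {b′} ab≈1 ab′≈1 = begin
    b              ≈⟨ solve 1 (λ x → x := x :* con (+ 1)) ≈-refl b ⟩
    b · 1#         ≈⟨ *-congˡ (≈-sym ab′≈1) ⟩
    b · (a · b′)   ≈⟨ solve 3 (λ x y z → x :* (y :* z) := (y :* x) :* z) ≈-refl b a b′ ⟩
    (a · b) · b′   ≈⟨ *-congʳ ab≈1 ⟩
    1# · b′        ≈⟨ *-identityˡ b′ ⟩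
    b′             ∎
    where open ≈-Reasoning

  ·-zeroˡ : ∀ {x} y → x ≈ 0# → x · y ≈ 0#
  ·-zeroˡ y x≈0 = ≈-trans (*-congʳ x≈0) (zeroˡ y)

  ·-zeroʳ : ∀ x {y} → y ≈ 0# → x · y ≈ 0#
  ·-zeroʳ x y≈0 = ≈-trans (*-congˡ y≈0) (zeroʳ x)

  nonzero-product : ∀ {x y} → x ≉ 0# → y ≉ 0# → x · y ≉ 0#
  nonzero-product {x} {y} x≉0 y≉0 xy≈0 = x≉0 (begin
    x                  ≈⟨ solve 1 (λ x → x := x :* con (+ 1)) ≈-refl x ⟩
    x · 1#             ≈⟨ *-congˡ (≈-sym (⁻¹-inverseʳ y≉0)) ⟩
    x · (y · y ⁻¹)     ≈⟨ solve 3 (λ x y z → x :* (y :* z) := (x :* y) :* z) ≈-refl x y (y ⁻¹) ⟩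
    (x · y) · y ⁻¹     ≈⟨ ·-zeroˡ (y ⁻¹) xy≈0 ⟩
    0#                 ∎)
    where open ≈-Reasoning

  zero-product : ∀ {x y} → x · y ≈ 0# → x ≈ 0# ⊎ y ≈ 0#
  zero-product {x} {y} xy≈0 with x ≟ 0# | y ≟ 0#
  ... | yes x≈0 | _       = inj₁ x≈0
  ... | no _    | yes y≈0 = inj₂ y≈0
  ... | no x≉0  | no y≉0  = ⊥-elim (nonzero-product x≉0 y≉0 xy≈0)

  ⁻¹-nonzero : ∀ {x} → x ≉ 0# → x ⁻¹ ≉ 0#
  ⁻¹-nonzero {x} x≉0 x⁻¹≈0 = 1≉0 (≈-trans (≈-sym (⁻¹-inverseʳ x≉0)) (·-zeroʳ x x⁻¹≈0))

  ⁻¹-cong : ∀ {x y} → x ≈ y → x ⁻¹ ≈ y ⁻¹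
  ⁻¹-cong {x} {y} x≈y with toSum (x ≟ 0#)
  ... | inj₁ x≈0 = ≈-trans (⁻¹-zero x≈0) (≈-sym (⁻¹-zero (≈-trans (≈-sym x≈y) x≈0)))
  ... | inj₂ x≉0 = inverse-unique (⁻¹-inverseʳ x≉0)
                     (≈-trans (*-congʳ x≈y) (⁻¹-inverseʳ (λ y≈0 → x≉0 (≈-trans x≈y y≈0))))

  ⁻¹-involutive : ∀ x → x ⁻¹ ⁻¹ ≈ x
  ⁻¹-involutive x with toSum (x ≟ 0#)
  ... | inj₁ x≈0 = ≈-trans (⁻¹-cong (⁻¹-zero x≈0)) (≈-trans (⁻¹-zero ≈-refl) (≈-sym x≈0))
  ... | inj₂ x≉0 = inverse-unique (⁻¹-inverseʳ (⁻¹-nonzero x≉0)) (⁻¹-inverseˡ x≉0)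

  ~-nonzero : ∀ {x} → x ≉ 0# → ~ x ≉ 0#
  ~-nonzero {x} x≉0 ~x≈0 = x≉0 (begin
    x          ≈⟨ solve 1 (λ x → x := :- (:- x)) ≈-refl x ⟩
    ~ (~ x)    ≈⟨ -‿cong ~x≈0 ⟩
    ~ 0#       ≈⟨ solve 0 (:- con (+ 0) := con (+ 0)) ≈-refl ⟩
    0#         ∎)
    where open ≈-Reasoning

  index : 𝔽 → Fin q
  index x = proj₁ (enum-surjective x)

  enum-index : ∀ x → enum (index x) ≈ x
  enum-index x = proj₂ (enum-surjective x)

  Σ𝔽 : (𝔽 → ℤ) → ℤ
  Σ𝔽 g = sum (λ i → g (enum i))

  Respects≈ : (𝔽 → ℤ) → Set (c ⊔ ℓ)
  Respects≈ g = ∀ {x y} → x ≈ y → g x ≡ g y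

  Σ𝔽-cong : ∀ {g h : 𝔽 → ℤ} → (∀ x → g x ≡ h x) → Σ𝔽 g ≡ Σ𝔽 h
  Σ𝔽-cong g≗h = sum-cong-≗ (λ i → g≗h (enum i))

  Σ𝔽-+ : ∀ g h → Σ𝔽 (λ x → g x + h x) ≡ Σ𝔽 g + Σ𝔽 h
  Σ𝔽-+ g h = ∑-distrib-+ (λ i → g (enum i)) (λ i → h (enum i))

  Σ𝔽-minus : ∀ g h → Σ𝔽 (λ x → g x - h x) ≡ Σ𝔽 g - Σ𝔽 h
  Σ𝔽-minus g h = sum-minus (λ i → g (enum i)) (λ i → h (enum i))

  Σ𝔽-scale : ∀ k g → Σ𝔽 (λ x → k * g x) ≡ k * Σ𝔽 g
  Σ𝔽-scale k g = sum-scale k (λ i → g (enum i))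

  Σ𝔽-one : Σ𝔽 (λ _ → + 1) ≡ + q
  Σ𝔽-one = trans (sum-const q (+ 1)) (ℤP.*-identityʳ (+ q))

  Σ𝔽-reindex : ∀ (g : 𝔽 → ℤ) → Respects≈ g → (φ ψ : 𝔽 → 𝔽)
    → (∀ {x y} → x ≈ y → φ x ≈ φ y) → (∀ {x y} → x ≈ y → ψ x ≈ ψ y)
    → (∀ x → φ (ψ x) ≈ x) → (∀ x → ψ (φ x) ≈ x)
    → Σ𝔽 g ≡ Σ𝔽 (λ x → g (φ x))
  Σ𝔽-reindex g g-resp φ ψ φ-cong ψ-cong φψ ψφ =
    trans (∑-permute (λ i → g (enum i)) (permutation σ τ στ τσ))
          (sum-cong-≗ (λ i → g-resp (enum-index (φ (enum i)))))
    where
    σ τ : Fin q → Fin q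
    σ i = index (φ (enum i))
    τ j = index (ψ (enum j))
    στ : ∀ j → σ (τ j) ≡ j
    στ j = enum-injective _ _ (≈-trans (enum-index _) (≈-trans (φ-cong (enum-index _)) (φψ _)))
    τσ : ∀ j → τ (σ j) ≡ j
    τσ j = enum-injective _ _ (≈-trans (enum-index _) (≈-trans (ψ-cong (enum-index _)) (ψφ _)))

  Σ𝔽-affine : ∀ (g : 𝔽 → ℤ) → Respects≈ g → ∀ {α} → α ≉ 0# → ∀ β
    → Σ𝔽 g ≡ Σ𝔽 (λ t → g (α · t ⊹ β))
  Σ𝔽-affine g g-resp {α} α≉0 β = Σ𝔽-reindex g g-resp (λ t → α · t ⊹ β) (λ u → α ⁻¹ · (u ⊹ ~ β))
    (λ e → +-congʳ (*-congˡ e)) (λ e → *-congˡ (+-congʳ e)) there-and-back back-and-there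
    where
    there-and-back : ∀ u → α · (α ⁻¹ · (u ⊹ ~ β)) ⊹ β ≈ u
    there-and-back u = begin
      α · (α ⁻¹ · (u ⊹ ~ β)) ⊹ β   ≈⟨ solve 4 (λ a w u b → a :* (w :* (u :+ :- b)) :+ b := (a :* w) :* (u :+ :- b) :+ b) ≈-refl α (α ⁻¹) u β ⟩
      (α · α ⁻¹) · (u ⊹ ~ β) ⊹ β   ≈⟨ +-congʳ (*-congʳ (⁻¹-inverseʳ α≉0)) ⟩
      1# · (u ⊹ ~ β) ⊹ β           ≈⟨ solve 2 (λ u b → con (+ 1) :* (u :+ :- b) :+ b := u) ≈-refl u β ⟩
      u                            ∎
      where open ≈-Reasoning
    back-and-there : ∀ t → α ⁻¹ · ((α · t ⊹ β) ⊹ ~ β) ≈ t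
    back-and-there t = begin
      α ⁻¹ · ((α · t ⊹ β) ⊹ ~ β)   ≈⟨ solve 4 (λ w a t b → w :* ((a :* t :+ b) :+ :- b) := (w :* a) :* t) ≈-refl (α ⁻¹) α t β ⟩
      (α ⁻¹ · α) · t               ≈⟨ *-congʳ (⁻¹-inverseˡ α≉0) ⟩
      1# · t                       ≈⟨ *-identityˡ t ⟩
      t                            ∎
      where open ≈-Reasoning

  Σ𝔽-dilate : ∀ (g : 𝔽 → ℤ) → Respects≈ g → ∀ {α} → α ≉ 0# → Σ𝔽 g ≡ Σ𝔽 (λ t → g (α · t))
  Σ𝔽-dilate g g-resp {α} α≉0 = trans (Σ𝔽-affine g g-resp α≉0 0#) (Σ𝔽-cong (λ t → g-resp (+-identityʳ (α · t))))

  Σ𝔽-⁻¹ : ∀ (g : 𝔽 → ℤ) → Respects≈ g → Σ𝔽 g ≡ Σ𝔽 (λ t → g (t ⁻¹))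
  Σ𝔽-⁻¹ g g-resp = Σ𝔽-reindex g g-resp _⁻¹ _⁻¹ ⁻¹-cong ⁻¹-cong ⁻¹-involutive ⁻¹-involutive

  δ : 𝔽 → 𝔽 → ℤ
  δ x y = 𝟙 (x ≟ y)

  δ-yes : ∀ {x y} → x ≈ y → δ x y ≡ + 1
  δ-yes {x} {y} = 𝟙-yes (x ≟ y)

  δ-no : ∀ {x y} → x ≉ y → δ x y ≡ + 0
  δ-no {x} {y} = 𝟙-no (x ≟ y)

  δ-iff : ∀ {x y x′ y′} → (x ≈ y → x′ ≈ y′) → (x′ ≈ y′ → x ≈ y) → δ x y ≡ δ x′ y′
  δ-iff {x} {y} {x′} {y′} to from with x ≟ y
  ... | yes x≈y = sym (δ-yes (to x≈y))
  ... | no x≉y  = sym (δ-no (λ x′≈y′ → x≉y (from x′≈y′)))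

  δ-sym : ∀ x y → δ x y ≡ δ y x
  δ-sym x y = δ-iff ≈-sym ≈-sym

  δ-respˡ : ∀ s → Respects≈ (λ x → δ x s)
  δ-respˡ s x≈y = δ-iff (λ x≈s → ≈-trans (≈-sym x≈y) x≈s) (≈-trans x≈y)

  Σ𝔽-δ : ∀ s (h : 𝔽 → ℤ) → Respects≈ h → Σ𝔽 (λ x → δ x s * h x) ≡ h s
  Σ𝔽-δ s h h-resp = begin
    Σ𝔽 (λ x → δ x s * h x)               ≡⟨ sum-single _ (index s) off-s ⟩
    δ (enum (index s)) s * h (enum (index s)) ≡⟨ cong₂ _*_ (δ-yes (enum-index s)) (h-resp (enum-index s)) ⟩
    + 1 * h s                             ≡⟨ ℤP.*-identityˡ (h s) ⟩
    h s                                   ∎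
    where
    open ≡-Reasoning
    off-s : ∀ j → j ≢ index s → δ (enum j) s * h (enum j) ≡ + 0
    off-s j j≢ = cong (_* h (enum j))
      (δ-no (λ e → j≢ (enum-injective j (index s) (≈-trans e (≈-sym (enum-index s))))))

  Σ𝔽-δ₁ : ∀ s → Σ𝔽 (λ x → δ x s) ≡ + 1
  Σ𝔽-δ₁ s = trans (Σ𝔽-cong (λ x → sym (ℤP.*-identityʳ (δ x s)))) (Σ𝔽-δ s (λ _ → + 1) (λ _ → refl))

  nonzero : 𝔽 → ℤ
  nonzero x = 𝟙 (¬? (x ≟ 0#))

  nonzero≡1-δ : ∀ x → nonzero x ≡ + 1 - δ x 0#
  nonzero≡1-δ x with x ≟ 0#
  ... | yes _ = refl
  ... | no _  = refl

  nonzero-0 : ∀ {x} → x ≈ 0# → nonzero x ≡ + 0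
  nonzero-0 {x} x≈0 = 𝟙-no (¬? (x ≟ 0#)) (λ x≉0 → x≉0 x≈0)

  nonzero-1 : ∀ {x} → x ≉ 0# → nonzero x ≡ + 1
  nonzero-1 {x} = 𝟙-yes (¬? (x ≟ 0#))

  Σ𝔽-nonzero : Σ𝔽 nonzero ≡ + q - + 1
  Σ𝔽-nonzero = begin
    Σ𝔽 nonzero                                ≡⟨ Σ𝔽-cong nonzero≡1-δ ⟩
    Σ𝔽 (λ x → + 1 - δ x 0#)                   ≡⟨ Σ𝔽-minus (λ _ → + 1) (λ x → δ x 0#) ⟩
    Σ𝔽 (λ _ → + 1) - Σ𝔽 (λ x → δ x 0#)        ≡⟨ cong₂ _-_ Σ𝔽-one (Σ𝔽-δ₁ 0#) ⟩
    + q - + 1                                 ∎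
    where open ≡-Reasoning

  Σ𝔽-linear₃ : ∀ A B C f g h → Σ𝔽 (λ x → A * f x + B * g x + C * h x) ≡ A * Σ𝔽 f + B * Σ𝔽 g + C * Σ𝔽 h
  Σ𝔽-linear₃ A B C f g h = begin
    Σ𝔽 (λ x → A * f x + B * g x + C * h x)               ≡⟨ Σ𝔽-+ (λ x → A * f x + B * g x) (λ x → C * h x) ⟩
    Σ𝔽 (λ x → A * f x + B * g x) + Σ𝔽 (λ x → C * h x)    ≡⟨ cong (_+ Σ𝔽 (λ x → C * h x)) (Σ𝔽-+ (λ x → A * f x) (λ x → B * g x)) ⟩
    Σ𝔽 (λ x → A * f x) + Σ𝔽 (λ x → B * g x) + Σ𝔽 (λ x → C * h x)
                                                          ≡⟨ cong₂ _+_ (cong₂ _+_ (Σ𝔽-scale A f) (Σ𝔽-scale B g)) (Σ𝔽-scale C h) ⟩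
    A * Σ𝔽 f + B * Σ𝔽 g + C * Σ𝔽 h                         ∎
    where open ≡-Reasoning

  Σ𝔽* : ∀ f → Respects≈ f → Σ𝔽 (λ x → nonzero x * f x) ≡ Σ𝔽 f - f 0#
  Σ𝔽* f f-resp = begin
    Σ𝔽 (λ x → nonzero x * f x)          ≡⟨ Σ𝔽-cong (λ x → cong (_* f x) (nonzero≡1-δ x)) ⟩
    Σ𝔽 (λ x → (+ 1 - δ x 0#) * f x)     ≡⟨ Σ𝔽-cong (λ x → ℤP.*-distribʳ-+ (f x) (+ 1) (- δ x 0#)) ⟩
    Σ𝔽 (λ x → + 1 * f x + - δ x 0# * f x)
                                        ≡⟨ Σ𝔽-cong (λ x → cong₂ _+_ (ℤP.*-identityˡ (f x)) (sym (ℤP.neg-distribˡ-* (δ x 0#) (f x)))) ⟩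
    Σ𝔽 (λ x → f x - δ x 0# * f x)       ≡⟨ Σ𝔽-minus f (λ x → δ x 0# * f x) ⟩
    Σ𝔽 f - Σ𝔽 (λ x → δ x 0# * f x)      ≡⟨ cong (λ z → Σ𝔽 f - z) (Σ𝔽-δ 0# f f-resp) ⟩
    Σ𝔽 f - f 0#                         ∎
    where open ≡-Reasoning

  c-bx² : 𝔽 → 𝔽 → 𝔽 → 𝔽
  c-bx² c b x = c ⊹ ~ (b · (x · x))

  c-bx²-cong : ∀ c b {x y} → x ≈ y → c-bx² c b x ≈ c-bx² c b y
  c-bx²-cong c b x≈y = +-congˡ (-‿cong (*-congˡ (*-cong x≈y x≈y)))

  -- The characteristic is not 2 when q is odd: if 1 + 1 = 0 then x ↦ x + 1
  -- would be a fixed-point-free involution of 𝔽, forcing q to be even.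
  odd-order⇒char≢2 : (∀ k → + q ≢ k + k) → Characteristic≢2 F
  odd-order⇒char≢2 q-odd 2≈0 = q-odd (proj₁ paired) q≡k+k
    where
    σ : Fin q → Fin q
    σ i = index (enum i ⊹ 1#)
    σσ : ∀ i → σ (σ i) ≡ i
    σσ i = enum-injective _ _ (begin
      enum (σ (σ i))        ≈⟨ enum-index _ ⟩
      enum (σ i) ⊹ 1#       ≈⟨ +-congʳ (enum-index _) ⟩
      (enum i ⊹ 1#) ⊹ 1#    ≈⟨ +-assoc _ _ _ ⟩
      enum i ⊹ (1# ⊹ 1#)    ≈⟨ +-congˡ 2≈0 ⟩
      enum i ⊹ 0#           ≈⟨ +-identityʳ _ ⟩
      enum i                ∎)
      where open ≈-Reasoning
    x+1≉x : ∀ x → x ⊹ 1# ≉ x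
    x+1≉x x e = 1≉0 (≈-trans (solve 1 (λ x → con (+ 1) := (x :+ con (+ 1)) :+ :- x) ≈-refl x)
                       (≈-trans (+-congʳ e) (-‿inverseʳ x)))
    no-fixed-points : ∀ i → 𝟙 (σ i FinP.≟ i) * + 1 ≡ + 0
    no-fixed-points i = cong (_* + 1) (𝟙-no (σ i FinP.≟ i)
      (λ σi≡i → x+1≉x (enum i) (≈-trans (≈-sym (enum-index _)) (reflexive (cong enum σi≡i)))))
    paired = involution-parity σ σσ (λ _ → + 1) (λ _ → refl)
    q≡k+k : + q ≡ proj₁ paired + proj₁ paired
    q≡k+k = begin
      + q                                      ≡⟨ sym Σ𝔽-one ⟩
      Σ𝔽 (λ _ → + 1)                           ≡⟨ sym (ℤP.+-identityʳ _) ⟩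
      Σ𝔽 (λ _ → + 1) + + 0                     ≡⟨ cong (λ z → Σ𝔽 (λ _ → + 1) + z) (sym (sum-zero no-fixed-points)) ⟩
      Σ𝔽 (λ _ → + 1) + sum (λ i → 𝟙 (σ i FinP.≟ i) * + 1) ≡⟨ proj₂ paired ⟩
      proj₁ paired + proj₁ paired              ∎
      where open ≡-Reasoning

module QuadraticCharacter {c ℓ} (F : CommutativeRing c ℓ) {q : ℕ} (FF : IsFiniteField F q)
  (char≢2 : Characteristic≢2 F) where
  open FieldFacts F FF public

  r≉~r : ∀ {r} → r ≉ 0# → r ≉ ~ r
  r≉~r {r} r≉0 r≈~r = [ char≢2 , r≉0 ]′ (zero-product 2r≈0)
    where
    2r≈0 : (1# ⊹ 1#) · r ≈ 0#
    2r≈0 = begin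
      (1# ⊹ 1#) · r   ≈⟨ solve 1 (λ r → (con (+ 1) :+ con (+ 1)) :* r := r :+ r) ≈-refl r ⟩
      r ⊹ r           ≈⟨ +-congʳ r≈~r ⟩
      ~ r ⊹ r         ≈⟨ -‿inverseˡ r ⟩
      0#              ∎
      where open ≈-Reasoning

  square-roots : ∀ {x r} → x · x ≈ r · r → x ≈ r ⊎ x ≈ ~ r
  square-roots {x} {r} x²≈r² with zero-product factored
    where
    factored : (x ⊹ ~ r) · (x ⊹ r) ≈ 0#
    factored = begin
      (x ⊹ ~ r) · (x ⊹ r)   ≈⟨ solve 2 (λ x r → (x :+ :- r) :* (x :+ r) := (x :* x) :+ :- (r :* r)) ≈-refl x r ⟩
      x · x ⊹ ~ (r · r)     ≈⟨ +-congʳ x²≈r² ⟩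
      r · r ⊹ ~ (r · r)     ≈⟨ -‿inverseʳ _ ⟩
      0#                    ∎
      where open ≈-Reasoning
  ... | inj₁ x-r≈0 = inj₁ (≈-trans (solve 2 (λ x r → x := (x :+ :- r) :+ r) ≈-refl x r)
                                   (≈-trans (+-congʳ x-r≈0) (+-identityˡ r)))
  ... | inj₂ x+r≈0 = inj₂ (≈-trans (solve 2 (λ x r → x := (x :+ r) :+ :- r) ≈-refl x r)
                                   (≈-trans (+-congʳ x+r≈0) (+-identityˡ (~ r))))

  square-zero : ∀ {x} → x · x ≈ 0# → x ≈ 0#
  square-zero x²≈0 = [ (λ x≈0 → x≈0) , (λ x≈0 → x≈0) ]′ (zero-product x²≈0)

  IsSquare-resp : ∀ {x y} → x ≈ y → IsSquare x → IsSquare y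
  IsSquare-resp x≈y (r , r²≈x) = r , ≈-trans r²≈x x≈y

  square-product : ∀ {x y} → IsSquare x → IsSquare y → IsSquare (x · y)
  square-product (r , r²≈x) (s , s²≈y) = r · s ,
    ≈-trans (solve 2 (λ r s → (r :* s) :* (r :* s) := (r :* r) :* (s :* s)) ≈-refl r s) (*-cong r²≈x s²≈y)

  nonsquare-times-square : ∀ {x y} → ¬ IsSquare x → IsSquare y → y ≉ 0# → ¬ IsSquare (x · y)
  nonsquare-times-square {x} {y} x-nonsq (s , s²≈y) y≉0 (z , z²≈xy) = x-nonsq (z · s ⁻¹ , (begin
    (z · s ⁻¹) · (z · s ⁻¹)            ≈⟨ solve 2 (λ z u → (z :* u) :* (z :* u) := (z :* z) :* (u :* u)) ≈-refl z (s ⁻¹) ⟩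
    (z · z) · (s ⁻¹ · s ⁻¹)            ≈⟨ *-congʳ (≈-trans z²≈xy (*-congˡ (≈-sym s²≈y))) ⟩
    (x · (s · s)) · (s ⁻¹ · s ⁻¹)      ≈⟨ solve 3 (λ x s u → (x :* (s :* s)) :* (u :* u) := x :* ((s :* u) :* (s :* u))) ≈-refl x s (s ⁻¹) ⟩
    x · ((s · s ⁻¹) · (s · s ⁻¹))      ≈⟨ *-congˡ (*-cong ss⁻¹≈1 ss⁻¹≈1) ⟩
    x · (1# · 1#)                      ≈⟨ solve 1 (λ x → x :* (con (+ 1) :* con (+ 1)) := x) ≈-refl x ⟩
    x                                  ∎))
    where
    open ≈-Reasoning
    ss⁻¹≈1 : s · s ⁻¹ ≈ 1#
    ss⁻¹≈1 = ⁻¹-inverseʳ (λ s≈0 → y≉0 (≈-trans (≈-sym s²≈y) (·-zeroˡ s s≈0)))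

  data Kind (x : 𝔽) : Set (c ⊔ ℓ) where
    is-zero      : x ≈ 0# → Kind x
    is-square    : x ≉ 0# → IsSquare x → Kind x
    is-nonsquare : x ≉ 0# → ¬ IsSquare x → Kind x

  kind : ∀ x → Kind x
  kind x with x ≟ 0# | isSquare? x
  ... | yes x≈0 | _          = is-zero x≈0
  ... | no x≉0  | yes x-sq   = is-square x≉0 x-sq
  ... | no x≉0  | no x-nonsq = is-nonsquare x≉0 x-nonsq

  χ : 𝔽 → ℤ
  χ x with x ≟ 0# | isSquare? x
  ... | yes _ | _     = + 0
  ... | no _  | yes _ = + 1
  ... | no _  | no _  = - + 1

  χ-zero : ∀ {x} → x ≈ 0# → χ x ≡ + 0
  χ-zero {x} x≈0 with x ≟ 0#
  ... | yes _   = refl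
  ... | no x≉0 = ⊥-elim (x≉0 x≈0)

  χ-square : ∀ {x} → x ≉ 0# → IsSquare x → χ x ≡ + 1
  χ-square {x} x≉0 x-sq with x ≟ 0# | isSquare? x
  ... | yes x≈0 | _          = ⊥-elim (x≉0 x≈0)
  ... | no _    | yes _      = refl
  ... | no _    | no x-nonsq = ⊥-elim (x-nonsq x-sq)

  χ-nonsquare : ∀ {x} → x ≉ 0# → ¬ IsSquare x → χ x ≡ - + 1
  χ-nonsquare {x} x≉0 x-nonsq with x ≟ 0# | isSquare? x
  ... | yes x≈0 | _        = ⊥-elim (x≉0 x≈0)
  ... | no _    | yes x-sq = ⊥-elim (x-nonsq x-sq)
  ... | no _    | no _     = refl

  χ-resp : Respects≈ χ
  χ-resp {x} {y} x≈y with kind x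
  ... | is-zero x≈0 = trans (χ-zero x≈0) (sym (χ-zero (≈-trans (≈-sym x≈y) x≈0)))
  ... | is-square x≉0 x-sq = trans (χ-square x≉0 x-sq)
      (sym (χ-square (λ y≈0 → x≉0 (≈-trans x≈y y≈0)) (IsSquare-resp x≈y x-sq)))
  ... | is-nonsquare x≉0 x-nonsq = trans (χ-nonsquare x≉0 x-nonsq)
      (sym (χ-nonsquare (λ y≈0 → x≉0 (≈-trans x≈y y≈0)) (λ y-sq → x-nonsq (IsSquare-resp (≈-sym x≈y) y-sq))))

  χ-one : χ 1# ≡ + 1
  χ-one = χ-square 1≉0 (1# , *-identityˡ 1#)

  χ²≡1 : ∀ {x} → x ≉ 0# → χ x * χ x ≡ + 1
  χ²≡1 {x} x≉0 with kind x
  ... | is-zero x≈0             = ⊥-elim (x≉0 x≈0)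
  ... | is-square _ x-sq        rewrite χ-square x≉0 x-sq = refl
  ... | is-nonsquare _ x-nonsq  rewrite χ-nonsquare x≉0 x-nonsq = refl

  #roots : 𝔽 → ℤ
  #roots t = Σ𝔽 (λ x → δ (x · x) t)

  #roots≡1+χ : ∀ t → #roots t ≡ + 1 + χ t
  #roots≡1+χ t with kind t
  ... | is-zero t≈0 = begin
      Σ𝔽 (λ x → δ (x · x) t)      ≡⟨ Σ𝔽-cong (λ x → δ-iff (λ x²≈t → square-zero (≈-trans x²≈t t≈0))
                                                       (λ x≈0 → ≈-trans (·-zeroˡ x x≈0) (≈-sym t≈0))) ⟩
      Σ𝔽 (λ x → δ x 0#)           ≡⟨ Σ𝔽-δ₁ 0# ⟩
      + 1                         ≡⟨ cong (λ z → + 1 + z) (sym (χ-zero t≈0)) ⟩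
      + 1 + χ t                   ∎
    where open ≡-Reasoning
  ... | is-nonsquare t≉0 t-nonsq =
      trans (sum-zero (λ i → δ-no (λ e → t-nonsq (enum i , e)))) (sym (cong (λ z → + 1 + z) (χ-nonsquare t≉0 t-nonsq)))
  ... | is-square t≉0 (r , r²≈t) = begin
      Σ𝔽 (λ x → δ (x · x) t)              ≡⟨ Σ𝔽-cong roots-±r ⟩
      Σ𝔽 (λ x → δ x r + δ x (~ r))        ≡⟨ Σ𝔽-+ (λ x → δ x r) (λ x → δ x (~ r)) ⟩
      Σ𝔽 (λ x → δ x r) + Σ𝔽 (λ x → δ x (~ r)) ≡⟨ cong₂ _+_ (Σ𝔽-δ₁ r) (Σ𝔽-δ₁ (~ r)) ⟩
      + 1 + + 1                           ≡⟨ cong (λ z → + 1 + z) (sym (χ-square t≉0 (r , r²≈t))) ⟩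
      + 1 + χ t                           ∎
    where
    open ≡-Reasoning
    r≉0 : r ≉ 0#
    r≉0 r≈0 = t≉0 (≈-trans (≈-sym r²≈t) (·-zeroˡ r r≈0))
    roots-±r : ∀ x → δ (x · x) t ≡ δ x r + δ x (~ r)
    roots-±r x with x ≟ r | x ≟ (~ r)
    ... | yes x≈r | yes x≈~r = ⊥-elim (r≉~r r≉0 (≈-trans (≈-sym x≈r) x≈~r))
    ... | yes x≈r | no _     = δ-yes (≈-trans (*-cong x≈r x≈r) r²≈t)
    ... | no _    | yes x≈~r = δ-yes (≈-trans (*-cong x≈~r x≈~r)
                                        (≈-trans (solve 1 (λ r → (:- r) :* (:- r) := r :* r) ≈-refl r) r²≈t))
    ... | no x≉r  | no x≉~r  = δ-no (λ x²≈t → [ x≉r , x≉~r ]′ (square-roots (≈-trans x²≈t (≈-sym r²≈t))))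

  -- Σ χ = 0: every x is the root of exactly one t, so Σ_t #roots t = q.
  Σχ≡0 : Σ𝔽 χ ≡ + 0
  Σχ≡0 = +-cancelˡ (+ q) (Σ𝔽 χ) (+ 0) (begin
    + q + Σ𝔽 χ                        ≡⟨ cong (_+ Σ𝔽 χ) (sym Σ𝔽-one) ⟩
    Σ𝔽 (λ _ → + 1) + Σ𝔽 χ             ≡⟨ sym (Σ𝔽-+ (λ _ → + 1) χ) ⟩
    Σ𝔽 (λ t → + 1 + χ t)              ≡⟨ sym (Σ𝔽-cong #roots≡1+χ) ⟩
    Σ𝔽 #roots                         ≡⟨ ∑-comm (λ i j → δ (enum j · enum j) (enum i)) ⟩
    sum (λ j → Σ𝔽 (λ t → δ (enum j · enum j) t)) ≡⟨ sum-cong-≗ (λ j → trans (Σ𝔽-cong (δ-sym (enum j · enum j))) (Σ𝔽-δ₁ (enum j · enum j))) ⟩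
    Σ𝔽 (λ _ → + 1)                    ≡⟨ Σ𝔽-one ⟩
    + q                               ≡⟨ sym (ℤP.+-identityʳ (+ q)) ⟩
    + q + + 0                         ∎)
    where open ≡-Reasoning

  𝟙□ 𝟙◇ : 𝔽 → ℤ
  𝟙□ x = 𝟙 (χ x ℤ.≟ + 1)
  𝟙◇ x = 𝟙 (χ x ℤ.≟ - + 1)

  𝟙□-resp : Respects≈ 𝟙□
  𝟙□-resp x≈y = cong (λ v → 𝟙 (v ℤ.≟ + 1)) (χ-resp x≈y)

  𝟙◇-resp : Respects≈ 𝟙◇
  𝟙◇-resp x≈y = cong (λ v → 𝟙 (v ℤ.≟ - + 1)) (χ-resp x≈y)

  χ≡𝟙□-𝟙◇ : ∀ x → χ x ≡ 𝟙□ x - 𝟙◇ x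
  χ≡𝟙□-𝟙◇ x with kind x
  ... | is-zero x≈0              rewrite χ-zero x≈0 = refl
  ... | is-square x≉0 x-sq       rewrite χ-square x≉0 x-sq = refl
  ... | is-nonsquare x≉0 x-nonsq rewrite χ-nonsquare x≉0 x-nonsq = refl

  kinds-partition : ∀ x → δ x 0# + 𝟙□ x + 𝟙◇ x ≡ + 1
  kinds-partition x with kind x
  ... | is-zero x≈0              rewrite χ-zero x≈0 | δ-yes x≈0 = refl
  ... | is-square x≉0 x-sq       rewrite χ-square x≉0 x-sq | δ-no x≉0 = refl
  ... | is-nonsquare x≉0 x-nonsq rewrite χ-nonsquare x≉0 x-nonsq | δ-no x≉0 = refl

  #squares #nonsquares : ℤ
  #squares    = Σ𝔽 𝟙□
  #nonsquares = Σ𝔽 𝟙◇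

  #squares≡#nonsquares : #squares ≡ #nonsquares
  #squares≡#nonsquares = ℤP.i-j≡0⇒i≡j #squares #nonsquares
    (trans (sym (Σ𝔽-minus 𝟙□ 𝟙◇)) (trans (sym (Σ𝔽-cong χ≡𝟙□-𝟙◇)) Σχ≡0))

  #squares-count : #squares + #squares + + 1 ≡ + q
  #squares-count = begin
    #squares + #squares + + 1                  ≡⟨ cong (λ s → #squares + s + + 1) #squares≡#nonsquares ⟩
    #squares + #nonsquares + + 1               ≡⟨ rotate #squares #nonsquares (+ 1) ⟩
    + 1 + #squares + #nonsquares               ≡⟨ cong (λ z → z + #squares + #nonsquares) (sym (Σ𝔽-δ₁ 0#)) ⟩
    Σ𝔽 (λ x → δ x 0#) + #squares + #nonsquares ≡⟨ cong (_+ #nonsquares) (sym (Σ𝔽-+ (λ x → δ x 0#) 𝟙□)) ⟩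
    Σ𝔽 (λ x → δ x 0# + 𝟙□ x) + #nonsquares     ≡⟨ sym (Σ𝔽-+ (λ x → δ x 0# + 𝟙□ x) 𝟙◇) ⟩
    Σ𝔽 (λ x → δ x 0# + 𝟙□ x + 𝟙◇ x)            ≡⟨ Σ𝔽-cong kinds-partition ⟩
    Σ𝔽 (λ _ → + 1)                             ≡⟨ Σ𝔽-one ⟩
    + q                                        ∎
    where
    open ≡-Reasoning
    rotate : ∀ a b c → a + b + c ≡ c + a + b
    rotate = solve-∀

  -- As x ↦ n·x permutes 𝔽, Σ_x χ(n·x) = 0;
  -- since χ(n·x) = -1 on the #squares nonzero squares, the values χ(n·x) ≤ 1
  -- on the #nonsquares = #squares nonsquares x must sum to #squares, so all
  -- of them are 1: the product of two nonsquares is a square.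
  module DilationByNonsquare {n} (n≉0 : n ≉ 0#) (n-nonsq : ¬ IsSquare n) where
    g : 𝔽 → ℤ
    g x = χ (n · x)

    g-split : ∀ x → g x ≡ - 𝟙□ x + 𝟙◇ x * g x
    g-split x with kind x
    ... | is-zero x≈0              rewrite χ-zero x≈0 = χ-zero (·-zeroʳ n x≈0)
    ... | is-square x≉0 x-sq       rewrite χ-square x≉0 x-sq =
          χ-nonsquare (nonzero-product n≉0 x≉0) (nonsquare-times-square n-nonsq x-sq x≉0)
    ... | is-nonsquare x≉0 x-nonsq rewrite χ-nonsquare x≉0 x-nonsq = sym (trans (ℤP.+-identityˡ _) (ℤP.*-identityˡ (g x)))

    on-nonsquares : Σ𝔽 (λ x → 𝟙◇ x * g x) ≡ #squares
    on-nonsquares = +-cancelˡ (- #squares) _ _ (begin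
      - #squares + Σ𝔽 (λ x → 𝟙◇ x * g x)          ≡⟨ cong (_+ Σ𝔽 (λ x → 𝟙◇ x * g x)) (sym (sum-neg (λ i → 𝟙□ (enum i)))) ⟩
      Σ𝔽 (λ x → - 𝟙□ x) + Σ𝔽 (λ x → 𝟙◇ x * g x)  ≡⟨ sym (Σ𝔽-+ (λ x → - 𝟙□ x) (λ x → 𝟙◇ x * g x)) ⟩
      Σ𝔽 (λ x → - 𝟙□ x + 𝟙◇ x * g x)             ≡⟨ sym (Σ𝔽-cong g-split) ⟩
      Σ𝔽 g                                       ≡⟨ sym (Σ𝔽-dilate χ χ-resp n≉0) ⟩
      Σ𝔽 χ                                       ≡⟨ Σχ≡0 ⟩
      + 0                                        ≡⟨ sym (ℤP.+-inverseˡ #squares) ⟩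
      - #squares + #squares                      ∎)
      where open ≡-Reasoning

    -- the defect 𝟙◇ x · (1 - g x) ∈ {0, 2} sums to zero, so it vanishes
    defect : 𝔽 → ℤ
    defect x = 𝟙◇ x * (+ 1 - g x)

    defect-resp : Respects≈ defect
    defect-resp x≈y = cong₂ (λ a b → a * (+ 1 - b)) (𝟙◇-resp x≈y) (χ-resp (*-congˡ x≈y))

    Σdefect≡0 : Σ𝔽 defect ≡ + 0
    Σdefect≡0 = begin
      Σ𝔽 defect                                 ≡⟨ Σ𝔽-cong (λ x → ℤP.*-distribˡ-+ (𝟙◇ x) (+ 1) (- g x)) ⟩
      Σ𝔽 (λ x → 𝟙◇ x * + 1 + 𝟙◇ x * - g x)      ≡⟨ Σ𝔽-cong (λ x → cong₂ _+_ (ℤP.*-identityʳ (𝟙◇ x))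
                                                                          (sym (ℤP.neg-distribʳ-* (𝟙◇ x) (g x)))) ⟩
      Σ𝔽 (λ x → 𝟙◇ x - 𝟙◇ x * g x)              ≡⟨ Σ𝔽-minus 𝟙◇ (λ x → 𝟙◇ x * g x) ⟩
      #nonsquares - Σ𝔽 (λ x → 𝟙◇ x * g x)       ≡⟨ cong₂ _-_ (sym #squares≡#nonsquares) on-nonsquares ⟩
      #squares - #squares                       ≡⟨ ℤP.+-inverseʳ #squares ⟩
      + 0                                       ∎
      where open ≡-Reasoning

    defect-natural : ∀ x → ∃ λ k → defect x ≡ + k
    defect-natural x with kind x
    ... | is-zero x≈0              rewrite χ-zero x≈0 = 0 , refl
    ... | is-square x≉0 x-sq       rewrite χ-square x≉0 x-sq = 0 , refl
    ... | is-nonsquare x≉0 x-nonsq rewrite χ-nonsquare x≉0 x-nonsq with kind (n · x)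
    ...   | is-zero nx≈0              = ⊥-elim (nonzero-product n≉0 x≉0 nx≈0)
    ...   | is-square nx≉0 nx-sq       rewrite χ-square nx≉0 nx-sq = 0 , refl
    ...   | is-nonsquare nx≉0 nx-nonsq rewrite χ-nonsquare nx≉0 nx-nonsq = 2 , refl

    defect-vanishes : ∀ x → defect x ≡ + 0
    defect-vanishes x = begin
      defect x                  ≡⟨ defect-resp (≈-sym (enum-index x)) ⟩
      defect (enum (index x))   ≡⟨ proj₂ (defect-natural (enum (index x))) ⟩
      + k (index x)             ≡⟨ cong +_ (sum-nonneg-zero k Σk≡0 (index x)) ⟩
      + 0                       ∎
      where
      open ≡-Reasoning
      k : Fin q → ℕ
      k j = proj₁ (defect-natural (enum j))
      Σk≡0 : sum (λ j → + k j) ≡ + 0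
      Σk≡0 = trans (sum-cong-≗ (λ j → sym (proj₂ (defect-natural (enum j))))) Σdefect≡0

    nonsquare-product : ∀ {t} → t ≉ 0# → ¬ IsSquare t → χ (n · t) ≡ + 1
    nonsquare-product {t} t≉0 t-nonsq = sym (ℤP.i-j≡0⇒i≡j (+ 1) (g t) (begin
      + 1 - g t                 ≡⟨ sym (ℤP.*-identityˡ _) ⟩
      + 1 * (+ 1 - g t)         ≡⟨ cong (λ v → 𝟙 (v ℤ.≟ - + 1) * (+ 1 - g t)) (sym (χ-nonsquare t≉0 t-nonsq)) ⟩
      defect t                  ≡⟨ defect-vanishes t ⟩
      + 0                       ∎))
      where open ≡-Reasoning

  χ-* : ∀ x y → χ (x · y) ≡ χ x * χ y
  χ-* x y with kind x | kind y
  ... | is-zero x≈0 | _ rewrite χ-zero x≈0 = χ-zero (·-zeroˡ y x≈0)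
  ... | is-square _ _ | is-zero y≈0 rewrite χ-zero y≈0 =
        trans (χ-zero (·-zeroʳ x y≈0)) (sym (ℤP.*-zeroʳ (χ x)))
  ... | is-nonsquare _ _ | is-zero y≈0 rewrite χ-zero y≈0 =
        trans (χ-zero (·-zeroʳ x y≈0)) (sym (ℤP.*-zeroʳ (χ x)))
  ... | is-square x≉0 x-sq | is-square y≉0 y-sq rewrite χ-square x≉0 x-sq | χ-square y≉0 y-sq =
        χ-square (nonzero-product x≉0 y≉0) (square-product x-sq y-sq)
  ... | is-square x≉0 x-sq | is-nonsquare y≉0 y-nonsq rewrite χ-square x≉0 x-sq | χ-nonsquare y≉0 y-nonsq =
        trans (χ-resp (*-comm x y)) (χ-nonsquare (nonzero-product y≉0 x≉0) (nonsquare-times-square y-nonsq x-sq x≉0))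
  ... | is-nonsquare x≉0 x-nonsq | is-square y≉0 y-sq rewrite χ-nonsquare x≉0 x-nonsq | χ-square y≉0 y-sq =
        χ-nonsquare (nonzero-product x≉0 y≉0) (nonsquare-times-square x-nonsq y-sq y≉0)
  ... | is-nonsquare x≉0 x-nonsq | is-nonsquare y≉0 y-nonsq rewrite χ-nonsquare x≉0 x-nonsq | χ-nonsquare y≉0 y-nonsq =
        DilationByNonsquare.nonsquare-product x≉0 x-nonsq y≉0 y-nonsq

  χ-neg : ∀ b → χ (~ b) ≡ χ (~ 1#) * χ b
  χ-neg b = trans (χ-resp (solve 1 (λ b → :- b := (:- con (+ 1)) :* b) ≈-refl b)) (χ-* (~ 1#) b)

  χ-square-factor : ∀ z {y} → y ≉ 0# → χ (z · (y · y)) ≡ χ z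
  χ-square-factor z {y} y≉0 = begin
    χ (z · (y · y))       ≡⟨ χ-* z (y · y) ⟩
    χ z * χ (y · y)       ≡⟨ cong (χ z *_) (trans (χ-* y y) (χ²≡1 y≉0)) ⟩
    χ z * + 1             ≡⟨ ℤP.*-identityʳ (χ z) ⟩
    χ z                   ∎
    where open ≡-Reasoning

  -- χ(x⁻¹) = χ(x), as x⁻¹ = x · (x⁻¹)².
  χ-⁻¹ : ∀ x → χ (x ⁻¹) ≡ χ x
  χ-⁻¹ x with toSum (x ≟ 0#)
  ... | inj₁ x≈0 = χ-resp (≈-trans (⁻¹-zero x≈0) (≈-sym x≈0))
  ... | inj₂ x≉0 = trans (χ-resp x⁻¹≈x·x⁻²) (χ-square-factor x (⁻¹-nonzero x≉0))
    where
    x⁻¹≈x·x⁻² : x ⁻¹ ≈ x · (x ⁻¹ · x ⁻¹)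
    x⁻¹≈x·x⁻² = begin
      x ⁻¹                   ≈⟨ ≈-sym (*-identityˡ _) ⟩
      1# · x ⁻¹              ≈⟨ *-congʳ (≈-sym (⁻¹-inverseʳ x≉0)) ⟩
      (x · x ⁻¹) · x ⁻¹      ≈⟨ *-assoc _ _ _ ⟩
      x · (x ⁻¹ · x ⁻¹)      ∎
      where open ≈-Reasoning

  self-inverse : ∀ {x} → x ≉ 0# → x ⁻¹ ≈ x → x ≈ 1# ⊎ x ≈ ~ 1#
  self-inverse {x} x≉0 x⁻¹≈x = square-roots (begin
    x · x       ≈⟨ *-congˡ (≈-sym x⁻¹≈x) ⟩
    x · x ⁻¹    ≈⟨ ⁻¹-inverseʳ x≉0 ⟩
    1#          ≈⟨ ≈-sym (*-identityˡ 1#) ⟩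
    1# · 1#     ∎)
    where open ≈-Reasoning

  1⁻¹≈1 : 1# ⁻¹ ≈ 1#
  1⁻¹≈1 = inverse-unique (⁻¹-inverseʳ 1≉0) (*-identityˡ 1#)

  -1⁻¹≈-1 : (~ 1#) ⁻¹ ≈ ~ 1#
  -1⁻¹≈-1 = inverse-unique (⁻¹-inverseʳ (~-nonzero 1≉0))
              (solve 0 (:- con (+ 1) :* :- con (+ 1) := con (+ 1)) ≈-refl)

  -- Pairing each x with x⁻¹ leaves the fixed points 0, 1, -1; the squares
  -- are closed under inversion, so #squares ≡ 𝟙□ 1 + 𝟙□ (-1)  (mod 2).
  minus-one-parity : ∃ λ k → #squares + (+ 1 + 𝟙□ (~ 1#)) ≡ k + k
  minus-one-parity = proj₁ paired , (begin
    #squares + (+ 1 + 𝟙□ (~ 1#))              ≡⟨ cong (λ z → #squares + z) (sym fixed-sum) ⟩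
    #squares + Σ𝔽 (λ x → δ x 1# + δ x (~ 1#) * 𝟙□ x)
                                              ≡⟨ cong (λ z → #squares + z) (sym (sum-cong-≗ fixed-points)) ⟩
    #squares + sum (λ i → 𝟙 (σ i FinP.≟ i) * 𝟙□ (enum i))
                                              ≡⟨ proj₂ paired ⟩
    proj₁ paired + proj₁ paired               ∎)
    where
    open ≡-Reasoning
    σ : Fin q → Fin q
    σ i = index (enum i ⁻¹)
    σσ : ∀ i → σ (σ i) ≡ i
    σσ i = enum-injective _ _ (≈-trans (enum-index _) (≈-trans (⁻¹-cong (enum-index _)) (⁻¹-involutive _)))
    paired = involution-parity σ σσ (λ i → 𝟙□ (enum i))
               (λ i → trans (𝟙□-resp (enum-index _)) (cong (λ v → 𝟙 (v ℤ.≟ + 1)) (χ-⁻¹ (enum i))))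
    σ-fixes : ∀ {i s} → enum i ≈ s → s ⁻¹ ≈ s → σ i ≡ i
    σ-fixes {i} eᵢ≈s s⁻¹≈s = enum-injective _ _
      (≈-trans (enum-index _) (≈-trans (⁻¹-cong eᵢ≈s) (≈-trans s⁻¹≈s (≈-sym eᵢ≈s))))
    fixed-points : ∀ i → 𝟙 (σ i FinP.≟ i) * 𝟙□ (enum i) ≡ δ (enum i) 1# + δ (enum i) (~ 1#) * 𝟙□ (enum i)
    fixed-points i with enum i ≟ 1# | enum i ≟ (~ 1#)
    ... | yes x≈1 | yes x≈-1 = ⊥-elim (r≉~r 1≉0 (≈-trans (≈-sym x≈1) x≈-1))
    ... | yes x≈1 | no _     = cong₂ _*_ (𝟙-yes (σ i FinP.≟ i) (σ-fixes x≈1 1⁻¹≈1)) (trans (𝟙□-resp x≈1) (cong (λ v → 𝟙 (v ℤ.≟ + 1)) χ-one))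
    ... | no _    | yes x≈-1 = trans (cong (_* 𝟙□ (enum i)) (𝟙-yes (σ i FinP.≟ i) (σ-fixes x≈-1 -1⁻¹≈-1))) (sym (ℤP.+-identityˡ _))
    ... | no x≉1  | no x≉-1 with toSum (enum i ≟ 0#)
    ...   | inj₁ x≈0 = trans (cong (𝟙 (σ i FinP.≟ i) *_) (cong (λ v → 𝟙 (v ℤ.≟ + 1)) (χ-zero x≈0)))
                             (ℤP.*-zeroʳ (𝟙 (σ i FinP.≟ i)))
    ...   | inj₂ x≉0 = cong (_* 𝟙□ (enum i)) (𝟙-no (σ i FinP.≟ i) (λ σi≡i → [ x≉1 , x≉-1 ]′
                         (self-inverse x≉0 (≈-trans (≈-sym (enum-index _)) (reflexive (cong enum σi≡i))))))
    fixed-sum : Σ𝔽 (λ x → δ x 1# + δ x (~ 1#) * 𝟙□ x) ≡ + 1 + 𝟙□ (~ 1#)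
    fixed-sum = trans (Σ𝔽-+ (λ x → δ x 1#) (λ x → δ x (~ 1#) * 𝟙□ x))
                      (cong₂ _+_ (Σ𝔽-δ₁ 1#) (Σ𝔽-δ (~ 1#) 𝟙□ 𝟙□-resp))

  #squares-from-q : ∀ h → + q ≡ h + h + + 1 → #squares ≡ h
  #squares-from-q h q≡2h+1 = halve #squares h
    (+-cancelʳ (+ 1) _ _ (trans #squares-count q≡2h+1))

  χ-minus-one-1mod4 : ∀ j → + q ≡ + 4 * j + + 1 → χ (~ 1#) ≡ + 1
  χ-minus-one-1mod4 j q≡4j+1 with kind (~ 1#)
  ... | is-zero -1≈0               = ⊥-elim (~-nonzero 1≉0 -1≈0)
  ... | is-square -1≉0 -1-sq       = χ-square -1≉0 -1-sq
  ... | is-nonsquare -1≉0 -1-nonsq = ⊥-elim (odd≢even j k (begin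
    j + j + + 1                       ≡⟨ regroup j ⟩
    (j + j) + (+ 1 + + 0)             ≡⟨ sym (cong₂ (λ s e → s + (+ 1 + e)) #squares≡2j 𝟙□-1≡0) ⟩
    #squares + (+ 1 + 𝟙□ (~ 1#))      ≡⟨ proj₂ minus-one-parity ⟩
    k + k                             ∎))
    where
    open ≡-Reasoning
    k = proj₁ minus-one-parity
    regroup : ∀ j → j + j + + 1 ≡ (j + j) + (+ 1 + + 0)
    regroup = solve-∀
    #squares≡2j : #squares ≡ j + j
    #squares≡2j = #squares-from-q (j + j) (trans q≡4j+1 (split j))
      where
      split : ∀ j → + 4 * j + + 1 ≡ (j + j) + (j + j) + + 1
      split = solve-∀
    𝟙□-1≡0 : 𝟙□ (~ 1#) ≡ + 0
    𝟙□-1≡0 = cong (λ v → 𝟙 (v ℤ.≟ + 1)) (χ-nonsquare -1≉0 -1-nonsq)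

  χ-minus-one-3mod4 : ∀ j → + q ≡ + 4 * j + + 3 → χ (~ 1#) ≡ - + 1
  χ-minus-one-3mod4 j q≡4j+3 with kind (~ 1#)
  ... | is-zero -1≈0               = ⊥-elim (~-nonzero 1≉0 -1≈0)
  ... | is-nonsquare -1≉0 -1-nonsq = χ-nonsquare -1≉0 -1-nonsq
  ... | is-square -1≉0 -1-sq       = ⊥-elim (odd≢even (j + + 1) k (begin
    (j + + 1) + (j + + 1) + + 1       ≡⟨ regroup j ⟩
    (j + j + + 1) + (+ 1 + + 1)       ≡⟨ sym (cong₂ (λ s e → s + (+ 1 + e)) #squares≡2j+1 𝟙□-1≡1) ⟩
    #squares + (+ 1 + 𝟙□ (~ 1#))      ≡⟨ proj₂ minus-one-parity ⟩
    k + k                             ∎))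
    where
    open ≡-Reasoning
    k = proj₁ minus-one-parity
    regroup : ∀ j → (j + + 1) + (j + + 1) + + 1 ≡ (j + j + + 1) + (+ 1 + + 1)
    regroup = solve-∀
    #squares≡2j+1 : #squares ≡ j + j + + 1
    #squares≡2j+1 = #squares-from-q (j + j + + 1) (trans q≡4j+3 (split j))
      where
      split : ∀ j → + 4 * j + + 3 ≡ (j + j + + 1) + (j + j + + 1) + + 1
      split = solve-∀
    𝟙□-1≡1 : 𝟙□ (~ 1#) ≡ + 1
    𝟙□-1≡1 = cong (λ v → 𝟙 (v ℤ.≟ + 1)) (χ-square -1≉0 -1-sq)

module CharacterSums {c ℓ} (F : CommutativeRing c ℓ) {q : ℕ} (FF : IsFiniteField F q)
  (char≢2 : Characteristic≢2 F) where
  open QuadraticCharacter F FF char≢2 public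

  Σχ-affine : ∀ {α} → α ≉ 0# → ∀ β → Σ𝔽 (λ t → χ (α · t ⊹ β)) ≡ + 0
  Σχ-affine α≉0 β = trans (sym (Σ𝔽-affine χ χ-resp α≉0 β)) Σχ≡0

  Σ𝔽-squares : ∀ (g : 𝔽 → ℤ) → Respects≈ g → Σ𝔽 (λ x → g (x · x)) ≡ Σ𝔽 (λ t → g t * #roots t)
  Σ𝔽-squares g g-resp = begin
    Σ𝔽 (λ x → g (x · x))                               ≡⟨ Σ𝔽-cong (λ x → sym (Σ𝔽-δ (x · x) g g-resp)) ⟩
    Σ𝔽 (λ x → Σ𝔽 (λ t → δ t (x · x) * g t))            ≡⟨ ∑-comm (λ i j → δ (enum j) (enum i · enum i) * g (enum j)) ⟩
    Σ𝔽 (λ t → Σ𝔽 (λ x → δ t (x · x) * g t))            ≡⟨ Σ𝔽-cong (λ t → Σ𝔽-cong (λ x →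
                                                            trans (cong (_* g t) (δ-sym t (x · x))) (ℤP.*-comm (δ (x · x) t) (g t)))) ⟩
    Σ𝔽 (λ t → Σ𝔽 (λ x → g t * δ (x · x) t))            ≡⟨ Σ𝔽-cong (λ t → Σ𝔽-scale (g t) (λ x → δ (x · x) t)) ⟩
    Σ𝔽 (λ t → g t * #roots t)                          ∎
    where open ≡-Reasoning

  inverted-form : ∀ {b c t} → t ≉ 0# → t ⁻¹ · (c ⊹ ~ (b · t ⁻¹)) ≈ (c · t ⊹ ~ b) · (t ⁻¹ · t ⁻¹)
  inverted-form {b} {c} {t} t≉0 = begin
    w · (c ⊹ ~ (b · w))                  ≈⟨ solve 3 (λ w c b → w :* (c :+ :- (b :* w)) := (c :* w) :* con (+ 1) :+ :- (b :* (w :* w))) ≈-refl w c b ⟩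
    (c · w) · 1# ⊹ ~ (b · (w · w))       ≈⟨ +-congʳ (*-congˡ (≈-sym (⁻¹-inverseʳ t≉0))) ⟩
    (c · w) · (t · w) ⊹ ~ (b · (w · w))  ≈⟨ solve 4 (λ c w t b → (c :* w) :* (t :* w) :+ :- (b :* (w :* w)) := (c :* t :+ :- b) :* (w :* w)) ≈-refl c w t b ⟩
    (c · t ⊹ ~ b) · (w · w)              ∎
    where
    w = t ⁻¹
    open ≈-Reasoning

  -- Σ_t χ(t)·χ(c - b·t) = -χ(-b) for c ≠ 0: after t ↦ t⁻¹ the summand becomes
  -- χ(c·t - b) for t ≠ 0, and Σ_{t ≠ 0} χ(c·t - b) = 0 - χ(-b).
  Σχ[t]χ[c-bt] : ∀ {b c} → c ≉ 0# → Σ𝔽 (λ t → χ t * χ (c ⊹ ~ (b · t))) ≡ - χ (~ b)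
  Σχ[t]χ[c-bt] {b} {c} c≉0 = begin
    Σ𝔽 (λ t → χ t * h t)                             ≡⟨ Σ𝔽-⁻¹ (λ t → χ t * h t) (λ e → cong₂ _*_ (χ-resp e) (h-resp e)) ⟩
    Σ𝔽 (λ t → χ (t ⁻¹) * h (t ⁻¹))                   ≡⟨ Σ𝔽-cong after-inversion ⟩
    Σ𝔽 (λ t → nonzero t * χ (c · t ⊹ ~ b))           ≡⟨ Σ𝔽* (λ t → χ (c · t ⊹ ~ b)) (λ e → χ-resp (+-congʳ (*-congˡ e))) ⟩
    Σ𝔽 (λ t → χ (c · t ⊹ ~ b)) - χ (c · 0# ⊹ ~ b)    ≡⟨ cong (_- χ (c · 0# ⊹ ~ b)) (Σχ-affine c≉0 (~ b)) ⟩
    + 0 - χ (c · 0# ⊹ ~ b)                           ≡⟨ cong (λ z → + 0 - z) (χ-resp (≈-trans (+-congʳ (zeroʳ c)) (+-identityˡ _))) ⟩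
    + 0 - χ (~ b)                                    ≡⟨ ℤP.+-identityˡ _ ⟩
    - χ (~ b)                                        ∎
    where
    open ≡-Reasoning
    h : 𝔽 → ℤ
    h t = χ (c ⊹ ~ (b · t))
    h-resp : Respects≈ h
    h-resp t≈u = χ-resp (+-congˡ (-‿cong (*-congˡ t≈u)))
    after-inversion : ∀ t → χ (t ⁻¹) * h (t ⁻¹) ≡ nonzero t * χ (c · t ⊹ ~ b)
    after-inversion t with toSum (t ≟ 0#)
    ... | inj₁ t≈0 = trans (cong (_* h (t ⁻¹)) (χ-zero (⁻¹-zero t≈0)))
                           (sym (cong (_* χ (c · t ⊹ ~ b)) (nonzero-0 t≈0)))
    ... | inj₂ t≉0 = begin
      χ (t ⁻¹) * h (t ⁻¹)                     ≡⟨ sym (χ-* (t ⁻¹) _) ⟩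
      χ (t ⁻¹ · (c ⊹ ~ (b · t ⁻¹)))           ≡⟨ χ-resp (inverted-form t≉0) ⟩
      χ ((c · t ⊹ ~ b) · (t ⁻¹ · t ⁻¹))       ≡⟨ χ-square-factor _ (⁻¹-nonzero t≉0) ⟩
      χ (c · t ⊹ ~ b)                         ≡⟨ sym (ℤP.*-identityˡ _) ⟩
      + 1 * χ (c · t ⊹ ~ b)                   ≡⟨ cong (_* χ (c · t ⊹ ~ b)) (sym (nonzero-1 t≉0)) ⟩
      nonzero t * χ (c · t ⊹ ~ b)             ∎

  -- Jacobsthal-type evaluation: Σ_x χ(c - b·x²) = -χ(-b) for b, c ≠ 0.
  -- The sum is Σ_t χ(c - b·t)·(1 + χ t), whose first part vanishes since
  -- t ↦ c - b·t permutes 𝔽.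
  Σχ[c-bx²] : ∀ {b c} → b ≉ 0# → c ≉ 0# → Σ𝔽 (λ x → χ (c-bx² c b x)) ≡ - χ (~ b)
  Σχ[c-bx²] {b} {c} b≉0 c≉0 = begin
    Σ𝔽 (λ x → χ (c-bx² c b x))                    ≡⟨ Σ𝔽-squares h h-resp ⟩
    Σ𝔽 (λ t → h t * #roots t)                     ≡⟨ Σ𝔽-cong (λ t → trans (cong (h t *_) (#roots≡1+χ t)) (ℤP.*-distribˡ-+ (h t) (+ 1) (χ t))) ⟩
    Σ𝔽 (λ t → h t * + 1 + h t * χ t)              ≡⟨ Σ𝔽-+ (λ t → h t * + 1) (λ t → h t * χ t) ⟩
    Σ𝔽 (λ t → h t * + 1) + Σ𝔽 (λ t → h t * χ t)   ≡⟨ cong₂ _+_ Σh≡0 (trans (Σ𝔽-cong (λ t → ℤP.*-comm (h t) (χ t))) (Σχ[t]χ[c-bt] c≉0)) ⟩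
    + 0 + - χ (~ b)                               ≡⟨ ℤP.+-identityˡ _ ⟩
    - χ (~ b)                                     ∎
    where
    open ≡-Reasoning
    h : 𝔽 → ℤ
    h t = χ (c ⊹ ~ (b · t))
    h-resp : Respects≈ h
    h-resp t≈u = χ-resp (+-congˡ (-‿cong (*-congˡ t≈u)))
    Σh≡0 : Σ𝔽 (λ t → h t * + 1) ≡ + 0
    Σh≡0 = trans (Σ𝔽-cong (λ t → trans (ℤP.*-identityʳ (h t))
                   (χ-resp (solve 3 (λ c b t → c :+ :- (b :* t) := (:- b) :* t :+ c) ≈-refl c b t))))
                 (Σχ-affine (~-nonzero b≉0) c)

  c-bx²-at-c≈0 : ∀ {c} b x → c ≈ 0# → c-bx² c b x ≈ ~ b · (x · x)
  c-bx²-at-c≈0 {c} b x c≈0 = ≈-trans (+-congʳ c≈0)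
    (solve 2 (λ b y → con (+ 0) :+ :- (b :* y) := (:- b) :* y) ≈-refl b (x · x))

  #zeros*-c≈0 : ∀ {b c} → b ≉ 0# → c ≈ 0# → Σ𝔽 (λ x → nonzero x * δ (c-bx² c b x) 0#) ≡ + 0
  #zeros*-c≈0 {b} {c} b≉0 c≈0 = sum-zero (λ i → no-zero (enum i))
    where
    no-zero : ∀ x → nonzero x * δ (c-bx² c b x) 0# ≡ + 0
    no-zero x with toSum (x ≟ 0#)
    ... | inj₁ x≈0 = cong (_* δ (c-bx² c b x) 0#) (nonzero-0 x≈0)
    ... | inj₂ x≉0 = trans (cong (nonzero x *_) (δ-no (λ e → nonzero-product (~-nonzero b≉0) (nonzero-product x≉0 x≉0)
                             (≈-trans (≈-sym (c-bx²-at-c≈0 b x c≈0)) e))))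
                           (ℤP.*-zeroʳ (nonzero x))

  root-of-c-bx² : ∀ {b c x} → b ≉ 0# → c-bx² c b x ≈ 0# → x · x ≈ b ⁻¹ · c
  root-of-c-bx² {b} {c} {x} b≉0 e = begin
    x · x                              ≈⟨ ≈-sym (*-identityˡ _) ⟩
    1# · (x · x)                       ≈⟨ *-congʳ (≈-sym (⁻¹-inverseˡ b≉0)) ⟩
    (b ⁻¹ · b) · (x · x)               ≈⟨ solve 4 (λ w b z c → (w :* b) :* z := w :* (c :+ :- (c :+ :- (b :* z)))) ≈-refl (b ⁻¹) b (x · x) c ⟩
    b ⁻¹ · (c ⊹ ~ c-bx² c b x)         ≈⟨ *-congˡ (+-congˡ (-‿cong e)) ⟩
    b ⁻¹ · (c ⊹ ~ 0#)                  ≈⟨ *-congˡ (solve 1 (λ c → c :+ :- con (+ 0) := c) ≈-refl c) ⟩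
    b ⁻¹ · c                           ∎
    where open ≈-Reasoning

  c-bx²-at-root : ∀ {b c x} → b ≉ 0# → x · x ≈ b ⁻¹ · c → c-bx² c b x ≈ 0#
  c-bx²-at-root {b} {c} {x} b≉0 e = begin
    c ⊹ ~ (b · (x · x))                ≈⟨ +-congˡ (-‿cong (*-congˡ e)) ⟩
    c ⊹ ~ (b · (b ⁻¹ · c))             ≈⟨ solve 3 (λ c b w → c :+ :- (b :* (w :* c)) := c :+ :- ((b :* w) :* c)) ≈-refl c b (b ⁻¹) ⟩
    c ⊹ ~ ((b · b ⁻¹) · c)             ≈⟨ +-congˡ (-‿cong (*-congʳ (⁻¹-inverseʳ b≉0))) ⟩
    c ⊹ ~ (1# · c)                     ≈⟨ solve 1 (λ c → c :+ :- (con (+ 1) :* c) := con (+ 0)) ≈-refl c ⟩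
    0#                                 ∎
    where open ≈-Reasoning

  -- For c ≠ 0 the zeros of c - b·x² are the 1 + χ(b⁻¹c) = 1 + χ(b)χ(c) square roots of b⁻¹c.
  #zeros*-c≉0 : ∀ {b c} → b ≉ 0# → c ≉ 0# → Σ𝔽 (λ x → nonzero x * δ (c-bx² c b x) 0#) ≡ + 1 + χ b * χ c
  #zeros*-c≉0 {b} {c} b≉0 c≉0 = begin
    Σ𝔽 (λ x → nonzero x * δ (c-bx² c b x) 0#)        ≡⟨ Σ𝔽* (λ x → δ (c-bx² c b x) 0#) (λ e → δ-respˡ 0# (c-bx²-cong c b e)) ⟩
    Σ𝔽 (λ x → δ (c-bx² c b x) 0#) - δ (c-bx² c b 0#) 0# ≡⟨ cong₂ _-_ (Σ𝔽-cong (λ x → δ-iff (root-of-c-bx² {x = x} b≉0) (c-bx²-at-root {x = x} b≉0)))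
                                                                     (δ-no c-b0²≉0) ⟩
    #roots (b ⁻¹ · c) - + 0                          ≡⟨ ℤP.+-identityʳ _ ⟩
    #roots (b ⁻¹ · c)                                ≡⟨ #roots≡1+χ (b ⁻¹ · c) ⟩
    + 1 + χ (b ⁻¹ · c)                               ≡⟨ cong (λ z → + 1 + z) (trans (χ-* (b ⁻¹) c) (cong (_* χ c) (χ-⁻¹ b))) ⟩
    + 1 + χ b * χ c                                  ∎
    where
    open ≡-Reasoning
    c-b0²≉0 : c-bx² c b 0# ≉ 0#
    c-b0²≉0 e = c≉0 (≈-trans (solve 2 (λ c b → c := c :+ :- (b :* (con (+ 0) :* con (+ 0)))) ≈-refl c b) e)

  Σ*χ[c-bx²]-c≈0 : ∀ {b c} → b ≉ 0# → c ≈ 0# → Σ𝔽 (λ x → nonzero x * χ (c-bx² c b x)) ≡ χ (~ b) * (+ q - + 1)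
  Σ*χ[c-bx²]-c≈0 {b} {c} b≉0 c≈0 =
    trans (Σ𝔽-cong constant-on-𝔽*) (trans (Σ𝔽-scale (χ (~ b)) nonzero) (cong (χ (~ b) *_) Σ𝔽-nonzero))
    where
    constant-on-𝔽* : ∀ x → nonzero x * χ (c-bx² c b x) ≡ χ (~ b) * nonzero x
    constant-on-𝔽* x with toSum (x ≟ 0#)
    ... | inj₁ x≈0 rewrite nonzero-0 x≈0 = sym (ℤP.*-zeroʳ (χ (~ b)))
    ... | inj₂ x≉0 rewrite nonzero-1 x≉0 =
          trans (ℤP.*-identityˡ _) (trans (χ-resp (c-bx²-at-c≈0 b x c≈0))
                (trans (χ-square-factor (~ b) x≉0) (sym (ℤP.*-identityʳ _))))

  -- For c ≠ 0, the Jacobsthal-type sum minus the term x = 0.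
  Σ*χ[c-bx²]-c≉0 : ∀ {b c} → b ≉ 0# → c ≉ 0# → Σ𝔽 (λ x → nonzero x * χ (c-bx² c b x)) ≡ - χ (~ b) - χ c
  Σ*χ[c-bx²]-c≉0 {b} {c} b≉0 c≉0 = begin
    Σ𝔽 (λ x → nonzero x * χ (c-bx² c b x))        ≡⟨ Σ𝔽* (λ x → χ (c-bx² c b x)) (λ e → χ-resp (c-bx²-cong c b e)) ⟩
    Σ𝔽 (λ x → χ (c-bx² c b x)) - χ (c-bx² c b 0#) ≡⟨ cong₂ _-_ (Σχ[c-bx²] b≉0 c≉0) (χ-resp c-b0²≈c) ⟩
    - χ (~ b) - χ c                               ∎
    where
    open ≡-Reasoning
    c-b0²≈c : c-bx² c b 0# ≈ c
    c-b0²≈c = solve 2 (λ c b → c :+ :- (b :* (con (+ 0) :* con (+ 0))) := c) ≈-refl c b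

length-filter-map : ∀ {a b p r} {A : Set a} {B : Set b} {P : A → Set p} {R : B → Set r}
  (P? : ∀ x → Dec (P x)) (R? : ∀ y → Dec (R y)) (g : B → A)
  → (∀ y → P (g y) → R y) → (∀ y → R y → P (g y))
  → ∀ ys → length (filter P? (List.map g ys)) ≡ length (filter R? ys)
length-filter-map P? R? g to from []       = refl
length-filter-map P? R? g to from (y ∷ ys) with R? y
... | yes Ry  = trans (cong length (ListP.filter-accept P? (from y Ry)))
                      (cong suc (length-filter-map P? R? g to from ys))
... | no ¬Ry = trans (cong length (ListP.filter-reject P? (λ Pgy → ¬Ry (to y Pgy))))
                     (length-filter-map P? R? g to from ys)

length-filter-concatMap : ∀ {a p} {A : Set a} {P : A → Set p} (P? : ∀ x → Dec (P x))
  {k} (f : Fin k → List A) {m} (h : Fin m → Fin k)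
  → + length (filter P? (List.concatMap f (List.tabulate h))) ≡ sum (λ i → + length (filter P? (f (h i))))
length-filter-concatMap P? f {zero}  h = refl
length-filter-concatMap P? f {suc m} h = begin
  + length (filter P? (f (h Fin.zero) List.++ rest))               ≡⟨ cong (λ l → + length l) (ListP.filter-++ P? (f (h Fin.zero)) rest) ⟩
  + length (filter P? (f (h Fin.zero)) List.++ filter P? rest)     ≡⟨ cong +_ (ListP.length-++ (filter P? (f (h Fin.zero)))) ⟩
  + (length (filter P? (f (h Fin.zero))) ℕ.+ length (filter P? rest))
                                                                   ≡⟨ ℤP.pos-+ (length (filter P? (f (h Fin.zero)))) _ ⟩
  + length (filter P? (f (h Fin.zero))) + + length (filter P? rest) ≡⟨ cong (λ z → + length (filter P? (f (h Fin.zero))) + z)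
                                                                         (length-filter-concatMap P? f (λ i → h (Fin.suc i))) ⟩
  sum (λ i → + length (filter P? (f (h i))))                       ∎
  where
  open ≡-Reasoning
  rest = List.concatMap f (List.tabulate (λ i → h (Fin.suc i)))

module Counting {c ℓ} (F : CommutativeRing c ℓ) {q : ℕ} (FF : IsFiniteField F q) where
  open FieldFacts F FF

  -- solutions with right-hand side c; Defs' Solution is the case c = 0
  Solutionᶜ : ∀ {n} → (Fin n → 𝔽) → 𝔽 → Vec (Fin q) n → Set ℓ
  Solutionᶜ a c v = (∀ i → ¬ (enum (lookup v i) ≈ 0#))
                  × (∑ (λ i → a i · (enum (lookup v i) · enum (lookup v i))) ≈ c)

  solutionᶜ? : ∀ {n} (a : Fin n → 𝔽) (c : 𝔽) (v : Vec (Fin q) n) → Dec (Solutionᶜ a c v)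
  solutionᶜ? a c v = FinP.all? (λ i → ¬? (enum (lookup v i) ≟ 0#)) ×-dec (_ ≟ c)

  N : ∀ n → (Fin n → 𝔽) → 𝔽 → ℕ
  N n a c = length (filter (solutionᶜ? a c) (allTuples n))

  N-zero : ∀ (a : Fin 0 → 𝔽) c → + N 0 a c ≡ δ c 0#
  N-zero a c with c ≟ 0#
  ... | yes c≈0 = cong (λ l → + length l) (ListP.filter-accept (solutionᶜ? a c) {xs = []} ((λ ()) , ≈-sym c≈0))
  ... | no c≉0  = cong (λ l → + length l) (ListP.filter-reject (solutionᶜ? a c) {xs = []} (λ s → c≉0 (≈-sym (proj₂ s))))

  module _ {n} (a : Fin (suc n) → 𝔽) (c : 𝔽) (i : Fin q) (v : Vec (Fin q) n) where
    private
      a′ : Fin n → 𝔽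
      a′ j = a (Fin.suc j)
      head-term : 𝔽
      head-term = a Fin.zero · (enum i · enum i)
      rest : 𝔽
      rest = ∑ (λ j → a′ j · (enum (lookup v j) · enum (lookup v j)))

    peel : Solutionᶜ a c (i ∷ v) → Solutionᶜ a′ (c-bx² c (a Fin.zero) (enum i)) v
    peel (nonzeros , total) = (λ j → nonzeros (Fin.suc j)) , (begin
      rest                             ≈⟨ solve 2 (λ x s → s := (x :+ s) :+ :- x) ≈-refl head-term rest ⟩
      (head-term ⊹ rest) ⊹ ~ head-term ≈⟨ +-congʳ total ⟩
      c ⊹ ~ head-term                  ∎)
      where open ≈-Reasoning

    unpeel : enum i ≉ 0# → Solutionᶜ a′ (c-bx² c (a Fin.zero) (enum i)) v → Solutionᶜ a c (i ∷ v)
    unpeel i≉0 (nonzeros , total) = all-nonzero , (begin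
      head-term ⊹ rest                 ≈⟨ +-congˡ total ⟩
      head-term ⊹ (c ⊹ ~ head-term)    ≈⟨ solve 2 (λ x c → x :+ (c :+ :- x) := c) ≈-refl head-term c ⟩
      c                                ∎)
      where
      open ≈-Reasoning
      all-nonzero : ∀ j → ¬ (enum (lookup (i ∷ v) j) ≈ 0#)
      all-nonzero Fin.zero    = i≉0
      all-nonzero (Fin.suc j) = nonzeros j

  N-first-coordinate : ∀ n (a : Fin (suc n) → 𝔽) c i
    → + length (filter (solutionᶜ? a c) (List.map (i ∷_) (allTuples n)))
      ≡ nonzero (enum i) * + N n (λ j → a (Fin.suc j)) (c-bx² c (a Fin.zero) (enum i))
  N-first-coordinate n a c i with toSum (enum i ≟ 0#)
  ... | inj₁ i≈0 = begin
    + length (filter (solutionᶜ? a c) (List.map (i ∷_) (allTuples n)))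
                   ≡⟨ cong (λ l → + length l) (ListP.filter-none (solutionᶜ? a c)
                        (map⁺ (universal (λ v s → proj₁ s Fin.zero i≈0) (allTuples n)))) ⟩
    + 0            ≡⟨ sym (cong (_* M) (nonzero-0 i≈0)) ⟩
    nonzero (enum i) * M ∎
    where
    open ≡-Reasoning
    M = + N n (λ j → a (Fin.suc j)) (c-bx² c (a Fin.zero) (enum i))
  ... | inj₂ i≉0 = begin
    + length (filter (solutionᶜ? a c) (List.map (i ∷_) (allTuples n)))
                   ≡⟨ cong +_ (length-filter-map (solutionᶜ? a c) (solutionᶜ? _ _) (i ∷_)
                        (peel a c i) (λ v → unpeel a c i v i≉0) (allTuples n)) ⟩
    M              ≡⟨ sym (ℤP.*-identityˡ M) ⟩
    + 1 * M        ≡⟨ cong (_* M) (sym (nonzero-1 i≉0)) ⟩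
    nonzero (enum i) * M ∎
    where
    open ≡-Reasoning
    M = + N n (λ j → a (Fin.suc j)) (c-bx² c (a Fin.zero) (enum i))

  N-suc : ∀ n (a : Fin (suc n) → 𝔽) c
    → + N (suc n) a c ≡ Σ𝔽 (λ x → nonzero x * + N n (λ j → a (Fin.suc j)) (c-bx² c (a Fin.zero) x))
  N-suc n a c = trans (length-filter-concatMap (solutionᶜ? a c) (λ i → List.map (i ∷_) (allTuples n)) (λ i → i))
                      (sum-cong-≗ (N-first-coordinate n a c))

#true : ∀ n → (Fin n → Bool) → ℕ
#true zero    s = 0
#true (suc n) s = if s Fin.zero then suc (#true n (λ i → s (Fin.suc i))) else #true n (λ i → s (Fin.suc i))

#true≤n : ∀ n s → #true n s ℕ.≤ n
#true≤n zero    s = ℕ.z≤n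
#true≤n (suc n) s with s Fin.zero
... | true  = ℕ.s≤s (#true≤n n (λ i → s (Fin.suc i)))
... | false = ℕP.m≤n⇒m≤1+n (#true≤n n (λ i → s (Fin.suc i)))

length-filter-tabulate : ∀ {a p} {A : Set a} {P : A → Set p} (P? : ∀ x → Dec (P x)) {m} (h : Fin m → A)
  → length (filter P? (List.tabulate h)) ≡ #true m (λ i → does (P? (h i)))
length-filter-tabulate P? {zero}  h = refl
length-filter-tabulate P? {suc m} h with P? (h Fin.zero)
... | yes _ = cong suc (length-filter-tabulate P? (λ i → h (Fin.suc i)))
... | no _  = length-filter-tabulate P? (λ i → h (Fin.suc i))

module ℤ√Facts (d : ℤ) where
  open ℤ√Ops d

  𝟏 : ℤ√
  𝟏 = (+ 1) + (+ 0) √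

  ⊗-assoc : ∀ x y z → (x ⊗ y) ⊗ z ≡ x ⊗ (y ⊗ z)
  ⊗-assoc (a + b √) (c + e √) (f + g √) = cong₂ _+_√ (re-law d a b c e f g) (im-law d a b c e f g)
    where
    re-law : ∀ d a b c e f g → (a * c + d * (b * e)) * f + d * ((a * e + b * c) * g)
                             ≡ a * (c * f + d * (e * g)) + d * (b * (c * g + e * f))
    re-law = solve-∀
    im-law : ∀ d a b c e f g → (a * c + d * (b * e)) * g + (a * e + b * c) * f
                             ≡ a * (c * g + e * f) + b * (c * f + d * (e * g))
    im-law = solve-∀

  ⊗-comm : ∀ x y → x ⊗ y ≡ y ⊗ x
  ⊗-comm (a + b √) (c + e √) = cong₂ _+_√ (re-law d a b c e) (im-law a b c e)
    where
    re-law : ∀ d a b c e → a * c + d * (b * e) ≡ c * a + d * (e * b)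
    re-law = solve-∀
    im-law : ∀ a b c e → a * e + b * c ≡ c * b + e * a
    im-law = solve-∀

  ⊗-identityˡ : ∀ x → 𝟏 ⊗ x ≡ x
  ⊗-identityˡ (a + b √) = cong₂ _+_√ (re-law d a b) (im-law a b)
    where
    re-law : ∀ d a b → + 1 * a + d * (+ 0 * b) ≡ a
    re-law = solve-∀
    im-law : ∀ a b → + 1 * b + + 0 * a ≡ b
    im-law = solve-∀

  conj : ℤ√ → ℤ√
  conj (a + b √) = a + (- b) √

  conj-⊗ : ∀ x y → conj (x ⊗ y) ≡ conj x ⊗ conj y
  conj-⊗ (a + b √) (c + e √) = cong₂ _+_√ (re-law d a b c e) (im-law a b c e)
    where
    re-law : ∀ d a b c e → a * c + d * (b * e) ≡ a * c + d * (- b * - e)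
    re-law = solve-∀
    im-law : ∀ a b c e → - (a * e + b * c) ≡ a * - e + - b * c
    im-law = solve-∀

  conj-^^ : ∀ x k → conj (x ^^ k) ≡ conj x ^^ k
  conj-^^ x zero    = refl
  conj-^^ x (suc k) = trans (conj-⊗ x (x ^^ k)) (cong (conj x ⊗_) (conj-^^ x k))

  ⊕-conj : ∀ x → x ⊕ conj x ≡ const (ℤ√.re x + ℤ√.re x)
  ⊕-conj (a + b √) = cong ((a + a) +_√) (ℤP.+-inverseʳ b)

  bracket≡⊕conj : ∀ n m → bracket n m ≡ (oneMinusRoot ^^ m) ⊗ (onePlusRoot ^^ (n ∸ m))
                                       ⊕ conj ((oneMinusRoot ^^ m) ⊗ (onePlusRoot ^^ (n ∸ m)))
  bracket≡⊕conj n m = cong ((oneMinusRoot ^^ m) ⊗ (onePlusRoot ^^ (n ∸ m)) ⊕_) (sym (begin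
    conj ((oneMinusRoot ^^ m) ⊗ (onePlusRoot ^^ (n ∸ m)))            ≡⟨ conj-⊗ (oneMinusRoot ^^ m) _ ⟩
    conj (oneMinusRoot ^^ m) ⊗ conj (onePlusRoot ^^ (n ∸ m))         ≡⟨ cong₂ _⊗_ (conj-^^ oneMinusRoot m) (conj-^^ onePlusRoot (n ∸ m)) ⟩
    (onePlusRoot ^^ m) ⊗ (oneMinusRoot ^^ (n ∸ m))                   ∎))
    where open ≡-Reasoning

  ∏ : ∀ n → (Fin n → ℤ√) → ℤ√
  ∏ zero    f = 𝟏
  ∏ (suc n) f = f Fin.zero ⊗ ∏ n (λ i → f (Fin.suc i))

  ∏-two-valued : ∀ n (s : Fin n → Bool) X Y
    → ∏ n (λ i → if s i then X else Y) ≡ (X ^^ #true n s) ⊗ (Y ^^ (n ∸ #true n s))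
  ∏-two-valued zero    s X Y = sym (⊗-identityˡ 𝟏)
  ∏-two-valued (suc n) s X Y with s Fin.zero
  ... | true  = trans (cong (X ⊗_) (∏-two-valued n s′ X Y)) (sym (⊗-assoc X (X ^^ k) (Y ^^ (n ∸ k))))
    where
    s′ = λ i → s (Fin.suc i)
    k = #true n s′
  ... | false = begin
    Y ⊗ ∏ n (λ i → if s′ i then X else Y)     ≡⟨ cong (Y ⊗_) (∏-two-valued n s′ X Y) ⟩
    Y ⊗ ((X ^^ k) ⊗ (Y ^^ (n ∸ k)))           ≡⟨ sym (⊗-assoc Y (X ^^ k) (Y ^^ (n ∸ k))) ⟩
    (Y ⊗ (X ^^ k)) ⊗ (Y ^^ (n ∸ k))           ≡⟨ cong (_⊗ (Y ^^ (n ∸ k))) (⊗-comm Y (X ^^ k)) ⟩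
    ((X ^^ k) ⊗ Y) ⊗ (Y ^^ (n ∸ k))           ≡⟨ ⊗-assoc (X ^^ k) Y (Y ^^ (n ∸ k)) ⟩
    (X ^^ k) ⊗ (Y ^^ suc (n ∸ k))             ≡⟨ cong (λ e → (X ^^ k) ⊗ (Y ^^ e)) (sym (ℕP.+-∸-assoc 1 (#true≤n n s′))) ⟩
    (X ^^ k) ⊗ (Y ^^ (suc n ∸ k))             ∎
    where
    open ≡-Reasoning
    s′ = λ i → s (Fin.suc i)
    k = #true n s′

  const-⊕-⊗ : ∀ a b c → const a ⊕ const b ⊗ const c ≡ const (a + b * c)
  const-⊕-⊗ a b c = cong₂ _+_√ (re-law d a b c) (im-law b c)
    where
    re-law : ∀ d a b c → a + (b * c + d * (+ 0 * + 0)) ≡ a + b * c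
    re-law = solve-∀
    im-law : ∀ b c → + 0 + (b * + 0 + + 0 * c) ≡ + 0
    im-law = solve-∀

module ClosedFormula {c ℓ} (F : CommutativeRing c ℓ) {q : ℕ} (FF : IsFiniteField F q)
  (char≢2 : Characteristic≢2 F)
  (d : ℤ) where
  open CharacterSums F FF char≢2
  open Counting F FF
  open ℤ√Ops d
  open ℤ√Facts d

  Q : ℤ
  Q = + q

  sign : ℕ → ℤ
  sign n = (- + 1) ℤ.^ n

  factor : 𝔽 → ℤ√
  factor b = if does (isSquare? b) then oneMinusRoot else onePlusRoot

  factor≡ : ∀ {b} → b ≉ 0# → factor b ≡ (+ 1) + (- χ b) √
  factor≡ {b} b≉0 with kind b
  ... | is-zero b≈0 = ⊥-elim (b≉0 b≈0)
  ... | is-square _ b-sq rewrite dec-true (isSquare? b) b-sq =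
        cong (λ v → (+ 1) + (- v) √) (sym (χ-square b≉0 b-sq))
  ... | is-nonsquare _ b-nonsq rewrite dec-false (isSquare? b) b-nonsq =
        cong (λ v → (+ 1) + (- v) √) (sym (χ-nonsquare b≉0 b-nonsq))

  U : ∀ n → (Fin n → 𝔽) → ℤ√
  U n a = ∏ n (λ i → factor (a i))

  U≡ : ∀ n a → U n a ≡ (oneMinusRoot ^^ numSquares n a) ⊗ (onePlusRoot ^^ (n ∸ numSquares n a))
  U≡ n a rewrite length-filter-tabulate (λ i → isSquare? (a i)) {n} (λ i → i) =
    ∏-two-valued n (λ i → does (isSquare? (a i))) oneMinusRoot onePlusRoot

  CountFormula : ∀ n → (Fin n → 𝔽) → Set c
  CountFormula n a = ∀ c → Q * + N n a c
    ≡ (Q - + 1) ℤ.^ n + sign n * ((Q * δ c 0# - + 1) * ℤ√.re (U n a) + Q * χ c * ℤ√.im (U n a))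

  -- n = 0: N(0, a, c) = [c = 0] and U = 1
  count-formula-zero : ∀ (a : Fin 0 → 𝔽) → CountFormula 0 a
  count-formula-zero a c = trans (cong (Q *_) (N-zero a c)) (algebra Q (δ c 0#) (χ c))
    where
    algebra : ∀ Q δ χ → Q * δ ≡ + 1 + + 1 * ((Q * δ - + 1) * + 1 + Q * χ * + 0)
    algebra = solve-∀

  -- Let b = a₁ ≠ 0 and assume the invariant for
  -- a′ = (a₂, …), with U n a′ = u + v√d.  Fixing x₁ = x ∈ 𝔽* and applying
  -- the invariant to c - b·x² reduces q·N(n+1, a, c) to the fibre sums of
  -- CharacterSums; U (n+1) a = (1 - χ(b)√d)·U n a′ gives the new u, v.
  module Step (d≡ηq : d ≡ χ (~ 1#) * Q) (n : ℕ) (a : Fin (suc n) → 𝔽) (b≉0 : a Fin.zero ≉ 0#)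
              (IH : CountFormula n (λ j → a (Fin.suc j))) where
    b : 𝔽
    b = a Fin.zero
    a′ : Fin n → 𝔽
    a′ j = a (Fin.suc j)
    u v s η P σ : ℤ
    u = ℤ√.re (U n a′)
    v = ℤ√.im (U n a′)
    s = χ b
    η = χ (~ 1#)
    P = (Q - + 1) ℤ.^ n
    σ = sign n
    -- the invariant for a′ at c′ is A + B·[c′ = 0] + C·χ(c′)
    A B C : ℤ
    A = P - σ * u
    B = σ * Q * u
    C = σ * Q * v
    K₀ Kχ : 𝔽 → ℤ
    K₀ c = Σ𝔽 (λ x → nonzero x * δ (c-bx² c b x) 0#)
    Kχ c = Σ𝔽 (λ x → nonzero x * χ (c-bx² c b x))

    expanded : ∀ c → Q * + N (suc n) a c ≡ A * (Q - + 1) + B * K₀ c + C * Kχ c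
    expanded c = begin
      Q * + N (suc n) a c                                  ≡⟨ cong (Q *_) (N-suc n a c) ⟩
      Q * Σ𝔽 (λ x → nonzero x * M x)                       ≡⟨ sym (Σ𝔽-scale Q (λ x → nonzero x * M x)) ⟩
      Σ𝔽 (λ x → Q * (nonzero x * M x))                     ≡⟨ Σ𝔽-cong split-IH ⟩
      Σ𝔽 (λ x → A * nonzero x + B * (nonzero x * δ (E x) 0#) + C * (nonzero x * χ (E x)))
                                                           ≡⟨ Σ𝔽-linear₃ A B C nonzero (λ x → nonzero x * δ (E x) 0#) (λ x → nonzero x * χ (E x)) ⟩
      A * Σ𝔽 nonzero + B * K₀ c + C * Kχ c                  ≡⟨ cong (λ z → A * z + B * K₀ c + C * Kχ c) Σ𝔽-nonzero ⟩
      A * (Q - + 1) + B * K₀ c + C * Kχ c                   ∎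
      where
      open ≡-Reasoning
      E : 𝔽 → 𝔽
      E x = c-bx² c b x
      M : 𝔽 → ℤ
      M x = + N n a′ (E x)
      split-IH : ∀ x → Q * (nonzero x * M x) ≡ A * nonzero x + B * (nonzero x * δ (E x) 0#) + C * (nonzero x * χ (E x))
      split-IH x = trans (regroup Q (nonzero x) (M x))
                         (trans (cong (nonzero x *_) (IH (E x))) (expand (nonzero x) P σ Q (δ (E x) 0#) u (χ (E x)) v))
        where
        regroup : ∀ Q z m → Q * (z * m) ≡ z * (Q * m)
        regroup = solve-∀
        expand : ∀ z P σ Q δ₀ u χ₀ v → z * (P + σ * ((Q * δ₀ - + 1) * u + Q * χ₀ * v))
               ≡ (P - σ * u) * z + σ * Q * u * (z * δ₀) + σ * Q * v * (z * χ₀)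
        expand = solve-∀

    -- U (n+1) a = (1 - s√d)·(u + v√d) = u′ + v′√d, using d = η·q
    u′ v′ : ℤ
    u′ = + 1 * u + η * Q * (- s * v)
    v′ = + 1 * v + - s * u

    re-U : ℤ√.re (U (suc n) a) ≡ u′
    re-U = trans (cong (λ f → ℤ√.re (f ⊗ U n a′)) (factor≡ b≉0)) (cong (λ d′ → + 1 * u + d′ * (- s * v)) d≡ηq)

    im-U : ℤ√.im (U (suc n) a) ≡ v′
    im-U = cong (λ f → ℤ√.im (f ⊗ U n a′)) (factor≡ b≉0)

    rhs : ℤ → ℤ → ℤ → ℤ → ℤ
    rhs δ₀ χ₀ r i = (Q - + 1) ℤ.^ suc n + sign (suc n) * ((Q * δ₀ - + 1) * r + Q * χ₀ * i)

    at-c≈0 : ∀ {c} → c ≈ 0# → A * (Q - + 1) + B * K₀ c + C * Kχ c ≡ rhs (δ c 0#) (χ c) u′ v′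
    at-c≈0 {c} c≈0 = begin
      A * (Q - + 1) + B * K₀ c + C * Kχ c
        ≡⟨ cong₂ (λ k₀ kχ → A * (Q - + 1) + B * k₀ + C * kχ) (#zeros*-c≈0 b≉0 c≈0)
                 (trans (Σ*χ[c-bx²]-c≈0 b≉0 c≈0) (cong (_* (Q - + 1)) (χ-neg b))) ⟩
      A * (Q - + 1) + B * + 0 + C * (η * s * (Q - + 1)) ≡⟨ algebra P σ Q u v s η ⟩
      rhs (+ 1) (+ 0) u′ v′                             ≡⟨ sym (cong₂ (λ δ₀ χ₀ → rhs δ₀ χ₀ u′ v′) (δ-yes c≈0) (χ-zero c≈0)) ⟩
      rhs (δ c 0#) (χ c) u′ v′                          ∎
      where
      open ≡-Reasoning
      algebra : ∀ P σ Q u v s η → (P - σ * u) * (Q - + 1) + σ * Q * u * + 0 + σ * Q * v * (η * s * (Q - + 1))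
              ≡ (Q - + 1) * P + (- + 1 * σ) * ((Q * + 1 - + 1) * (+ 1 * u + η * Q * (- s * v)) + Q * + 0 * (+ 1 * v + - s * u))
      algebra = solve-∀

    at-c≉0 : ∀ {c} → c ≉ 0# → A * (Q - + 1) + B * K₀ c + C * Kχ c ≡ rhs (δ c 0#) (χ c) u′ v′
    at-c≉0 {c} c≉0 = begin
      A * (Q - + 1) + B * K₀ c + C * Kχ c
        ≡⟨ cong₂ (λ k₀ kχ → A * (Q - + 1) + B * k₀ + C * kχ) (#zeros*-c≉0 b≉0 c≉0)
                 (trans (Σ*χ[c-bx²]-c≉0 b≉0 c≉0) (cong (λ z → - z - χ c) (χ-neg b))) ⟩
      A * (Q - + 1) + B * (+ 1 + s * χ c) + C * (- (η * s) - χ c) ≡⟨ algebra P σ Q u v s η (χ c) ⟩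
      rhs (+ 0) (χ c) u′ v′                             ≡⟨ sym (cong (λ δ₀ → rhs δ₀ (χ c) u′ v′) (δ-no c≉0)) ⟩
      rhs (δ c 0#) (χ c) u′ v′                          ∎
      where
      open ≡-Reasoning
      algebra : ∀ P σ Q u v s η w → (P - σ * u) * (Q - + 1) + σ * Q * u * (+ 1 + s * w) + σ * Q * v * (- (η * s) - w)
              ≡ (Q - + 1) * P + (- + 1 * σ) * ((Q * + 0 - + 1) * (+ 1 * u + η * Q * (- s * v)) + Q * w * (+ 1 * v + - s * u))
      algebra = solve-∀

    count-formula-suc : CountFormula (suc n) a
    count-formula-suc c = begin
      Q * + N (suc n) a c                   ≡⟨ expanded c ⟩
      A * (Q - + 1) + B * K₀ c + C * Kχ c   ≡⟨ [ at-c≈0 , at-c≉0 ]′ (toSum (c ≟ 0#)) ⟩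
      rhs (δ c 0#) (χ c) u′ v′              ≡⟨ cong₂ (rhs (δ c 0#) (χ c)) (sym re-U) (sym im-U) ⟩
      rhs (δ c 0#) (χ c) (ℤ√.re (U (suc n) a)) (ℤ√.im (U (suc n) a)) ∎
      where open ≡-Reasoning

  count-formula : d ≡ χ (~ 1#) * Q → ∀ n (a : Fin n → 𝔽) → (∀ i → a i ≉ 0#) → CountFormula n a
  count-formula d≡ηq zero    a _        = count-formula-zero a
  count-formula d≡ηq (suc n) a a-nonzero =
    Step.count-formula-suc d≡ηq n a (a-nonzero Fin.zero)
      (count-formula d≡ηq n (λ j → a (Fin.suc j)) (λ j → a-nonzero (Fin.suc j)))

  bracket≡U+Ū : ∀ n a → const (ℤ√.re (U n a) + ℤ√.re (U n a)) ≡ bracket n (numSquares n a)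
  bracket≡U+Ū n a = begin
    const (ℤ√.re (U n a) + ℤ√.re (U n a)) ≡⟨ sym (⊕-conj (U n a)) ⟩
    U n a ⊕ conj (U n a)                  ≡⟨ cong (λ z → z ⊕ conj z) (U≡ n a) ⟩
    (oneMinusRoot ^^ numSquares n a) ⊗ (onePlusRoot ^^ (n ∸ numSquares n a))
      ⊕ conj ((oneMinusRoot ^^ numSquares n a) ⊗ (onePlusRoot ^^ (n ∸ numSquares n a)))
                                          ≡⟨ sym (bracket≡⊕conj n (numSquares n a)) ⟩
    bracket n (numSquares n a)            ∎
    where open ≡-Reasoning

  formula : d ≡ χ (~ 1#) * Q → 1 ℕ.≤ q → ∀ n (a : Fin n → 𝔽) → (∀ i → a i ≉ 0#)
    → FormulaHolds q n (numSquares n a) (Nstar n a)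
  formula d≡ηq q≥1 n a a-nonzero = begin
    const (+ (2 ℕ.* q ℕ.* Nstar n a))                    ≡⟨ cong const doubled ⟩
    const (+ 2 * q-1 ℤ.^ n + sign n * q-1 * (u + u))      ≡⟨ sym (const-⊕-⊗ (+ 2 * q-1 ℤ.^ n) (sign n * q-1) (u + u)) ⟩
    const (+ 2 * q-1 ℤ.^ n) ⊕ const (sign n * q-1) ⊗ const (u + u)
                                                         ≡⟨ cong (λ z → const (+ 2 * q-1 ℤ.^ n) ⊕ const (sign n * q-1) ⊗ z) (bracket≡U+Ū n a) ⟩
    const (+ 2 * q-1 ℤ.^ n) ⊕ const (sign n * q-1) ⊗ bracket n (numSquares n a) ∎
    where
    open ≡-Reasoning
    q-1 : ℤ
    q-1 = + (q ∸ 1)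
    u v : ℤ
    u = ℤ√.re (U n a)
    v = ℤ√.im (U n a)
    q-1≡Q-1 : q-1 ≡ Q - + 1
    q-1≡Q-1 = sym (trans (ℤP.m-n≡m⊖n q 1) (ℤP.⊖-≥ q≥1))
    at-zero : Q * + Nstar n a ≡ (Q - + 1) ℤ.^ n + sign n * ((Q * + 1 - + 1) * u + Q * + 0 * v)
    at-zero = trans (count-formula d≡ηq n a a-nonzero 0#)
      (cong₂ (λ δ₀ χ₀ → (Q - + 1) ℤ.^ n + sign n * ((Q * δ₀ - + 1) * u + Q * χ₀ * v)) (δ-yes ≈-refl) (χ-zero ≈-refl))
    doubled : + (2 ℕ.* q ℕ.* Nstar n a) ≡ + 2 * q-1 ℤ.^ n + sign n * q-1 * (u + u)
    doubled = begin
      + (2 ℕ.* q ℕ.* Nstar n a)                        ≡⟨ trans (ℤP.pos-* (2 ℕ.* q) _) (cong (_* + Nstar n a) (ℤP.pos-* 2 q)) ⟩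
      + 2 * Q * + Nstar n a                            ≡⟨ ℤP.*-assoc (+ 2) Q _ ⟩
      + 2 * (Q * + Nstar n a)                          ≡⟨ cong (+ 2 *_) at-zero ⟩
      + 2 * ((Q - + 1) ℤ.^ n + sign n * ((Q * + 1 - + 1) * u + Q * + 0 * v))
                                                       ≡⟨ algebra Q (sign n) u v ((Q - + 1) ℤ.^ n) ⟩
      + 2 * (Q - + 1) ℤ.^ n + sign n * (Q - + 1) * (u + u)
                                                       ≡⟨ cong (λ k → + 2 * k ℤ.^ n + sign n * k * (u + u)) (sym q-1≡Q-1) ⟩
      + 2 * q-1 ℤ.^ n + sign n * q-1 * (u + u)          ∎
      where
      algebra : ∀ Q σ u v P → + 2 * (P + σ * ((Q * + 1 - + 1) * u + Q * + 0 * v)) ≡ + 2 * P + σ * (Q - + 1) * (u + u)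
      algebra = solve-∀

pow-1mod4 : ∀ {p} → p % 4 ≡ 1 → ∀ s → p ^ s % 4 ≡ 1
pow-1mod4 {p} p≡1 zero    = refl
pow-1mod4 {p} p≡1 (suc s) = begin
  p ℕ.* p ^ s % 4                 ≡⟨ %-distribˡ-* p (p ^ s) 4 ⟩
  (p % 4) ℕ.* (p ^ s % 4) % 4     ≡⟨ cong₂ (λ x y → x ℕ.* y % 4) p≡1 (pow-1mod4 p≡1 s) ⟩
  1                               ∎
  where open ≡-Reasoning

pow-mod4-parity : ∀ {p} → p ℕ.* p % 4 ≡ 1 → ∀ s → p ^ s % 4 ≡ p ^ (s % 2) % 4
pow-mod4-parity p²≡1 zero          = refl
pow-mod4-parity p²≡1 (suc zero)    = refl
pow-mod4-parity {p} p²≡1 (suc (suc s)) = begin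
  p ℕ.* (p ℕ.* p ^ s) % 4                   ≡⟨ cong (_% 4) (sym (ℕP.*-assoc p p (p ^ s))) ⟩
  p ℕ.* p ℕ.* p ^ s % 4                     ≡⟨ %-distribˡ-* (p ℕ.* p) (p ^ s) 4 ⟩
  (p ℕ.* p % 4) ℕ.* (p ^ s % 4) % 4         ≡⟨ cong₂ (λ x y → x ℕ.* y % 4) p²≡1 (pow-mod4-parity {p} p²≡1 s) ⟩
  1 ℕ.* (p ^ (s % 2) % 4) % 4               ≡⟨ cong (_% 4) (ℕP.*-identityˡ (p ^ (s % 2) % 4)) ⟩
  p ^ (s % 2) % 4 % 4                       ≡⟨ m%n%n≡m%n (p ^ (s % 2)) 4 ⟩
  p ^ (s % 2) % 4                           ∎
  where open ≡-Reasoning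

square-3mod4 : ∀ {p} → p % 4 ≡ 3 → p ℕ.* p % 4 ≡ 1
square-3mod4 {p} p≡3 = trans (%-distribˡ-* p p 4) (cong₂ (λ x y → x ℕ.* y % 4) p≡3 p≡3)

pow-3mod4-even : ∀ {p} → p % 4 ≡ 3 → ∀ s → s % 2 ≡ 0 → p ^ s % 4 ≡ 1
pow-3mod4-even {p} p≡3 s s-even = trans (pow-mod4-parity {p} (square-3mod4 {p} p≡3) s) (cong (λ e → p ^ e % 4) s-even)

pow-3mod4-odd : ∀ {p} → p % 4 ≡ 3 → ∀ s → s % 2 ≡ 1 → p ^ s % 4 ≡ 3
pow-3mod4-odd {p} p≡3 s s-odd = begin
  p ^ s % 4               ≡⟨ pow-mod4-parity {p} (square-3mod4 {p} p≡3) s ⟩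
  p ^ (s % 2) % 4         ≡⟨ cong (λ e → p ^ e % 4) s-odd ⟩
  p ℕ.* 1 % 4             ≡⟨ cong (_% 4) (ℕP.*-identityʳ p) ⟩
  p % 4                   ≡⟨ p≡3 ⟩
  3                       ∎
  where open ≡-Reasoning

mod4-form : ∀ {m r} → m % 4 ≡ r → + m ≡ + 4 * + (m / 4) + + r
mod4-form {m} {r} m%4≡r = begin
  + m                              ≡⟨ cong +_ (m≡m%n+[m/n]*n m 4) ⟩
  + (m % 4 ℕ.+ m / 4 ℕ.* 4)        ≡⟨ cong (λ x → + (x ℕ.+ m / 4 ℕ.* 4)) m%4≡r ⟩
  + (r ℕ.+ m / 4 ℕ.* 4)            ≡⟨ trans (ℤP.pos-+ r _) (cong (λ z → + r + z) (ℤP.pos-* (m / 4) 4)) ⟩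
  + r + + (m / 4) * + 4            ≡⟨ rearrange (+ r) (+ (m / 4)) ⟩
  + 4 * + (m / 4) + + r            ∎
  where
  open ≡-Reasoning
  rearrange : ∀ r k → r + k * + 4 ≡ + 4 * k + r
  rearrange = solve-∀

positive-of-residue : ∀ {m r} → m % 4 ≡ suc r → 1 ≤ m
positive-of-residue {zero}  ()
positive-of-residue {suc m} _ = ℕ.s≤s ℕ.z≤n

not-even : ∀ {x} h → x ≡ h + h + + 1 → ∀ k → x ≢ k + k
not-even h x≡2h+1 k x≡2k = odd≢even h k (trans (sym x≡2h+1) x≡2k)

-- The closed formula for a field of order q ≡ 1 resp. 3 (mod 4), where
-- d = χ(-1)·q equals q resp. -q.
module FormulaByResidue {c ℓ} (F : CommutativeRing c ℓ) {q : ℕ} (FF : IsFiniteField F q) where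
  open FieldFacts F FF using (𝔽; _≈_; 0#; odd-order⇒char≢2)

  formula-1mod4 : q % 4 ≡ 1 → ∀ n (a : Fin n → 𝔽) → (∀ i → ¬ (a i ≈ 0#))
    → ℤ√Ops.FormulaHolds (+ q) q n (FiniteFieldNotions.numSquares F FF n a) (FiniteFieldNotions.Nstar F FF n a)
  formula-1mod4 q%4≡1 = ClosedFormula.formula F FF char≢2 (+ q) q≡χ[-1]q (positive-of-residue q%4≡1)
    where
    j = + (q / 4)
    q≡2h+1 : + q ≡ (j + j) + (j + j) + + 1
    q≡2h+1 = trans (mod4-form q%4≡1) (rearrange j)
      where
      rearrange : ∀ j → + 4 * j + + 1 ≡ (j + j) + (j + j) + + 1
      rearrange = solve-∀
    char≢2 = odd-order⇒char≢2 (not-even (j + j) q≡2h+1)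
    open QuadraticCharacter F FF char≢2 using (χ; ~_; 1#; χ-minus-one-1mod4)
    q≡χ[-1]q : + q ≡ χ (~ 1#) * + q
    q≡χ[-1]q = sym (trans (cong (_* + q) (χ-minus-one-1mod4 j (mod4-form q%4≡1))) (ℤP.*-identityˡ (+ q)))

  formula-3mod4 : q % 4 ≡ 3 → ∀ n (a : Fin n → 𝔽) → (∀ i → ¬ (a i ≈ 0#))
    → ℤ√Ops.FormulaHolds (ℤ.- + q) q n (FiniteFieldNotions.numSquares F FF n a) (FiniteFieldNotions.Nstar F FF n a)
  formula-3mod4 q%4≡3 = ClosedFormula.formula F FF char≢2 (ℤ.- + q) -q≡χ[-1]q (positive-of-residue q%4≡3)
    where
    j = + (q / 4)
    q≡2h+1 : + q ≡ (j + j + + 1) + (j + j + + 1) + + 1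
    q≡2h+1 = trans (mod4-form q%4≡3) (rearrange j)
      where
      rearrange : ∀ j → + 4 * j + + 3 ≡ (j + j + + 1) + (j + j + + 1) + + 1
      rearrange = solve-∀
    char≢2 = odd-order⇒char≢2 (not-even (j + j + + 1) q≡2h+1)
    open QuadraticCharacter F FF char≢2 using (χ; ~_; 1#; χ-minus-one-3mod4)
    -q≡χ[-1]q : ℤ.- + q ≡ χ (~ 1#) * + q
    -q≡χ[-1]q = sym (trans (cong (_* + q) (χ-minus-one-3mod4 j (mod4-form q%4≡3))) (ℤP.-1*i≡-i (+ q)))

-- Theorem 3.5.  Only the residue of q = pˢ modulo 4 enters the proof.
theorem3p5 : ∀ {c ℓ} (p s n : ℕ) → Prime p → ¬ (p ≡ 2) → 1 ≤ s → 1 ≤ n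
    → (F : CommutativeRing c ℓ) (FF : IsFiniteField F (p ^ s))
    → (a : Fin n → CommutativeRing.Carrier F)
    → (∀ i → ¬ (CommutativeRing._≈_ F (a i) (CommutativeRing.0# F)))
    → ((p % 4 ≡ 1 ⊎ (p % 4 ≡ 3 × s % 2 ≡ 0))
         → ℤ√Ops.FormulaHolds (+ (p ^ s)) (p ^ s) n
             (FiniteFieldNotions.numSquares F FF n a) (FiniteFieldNotions.Nstar F FF n a))
     × ((p % 4 ≡ 3 × s % 2 ≡ 1)
         → ℤ√Ops.FormulaHolds (ℤ.- (+ (p ^ s))) (p ^ s) n
             (FiniteFieldNotions.numSquares F FF n a) (FiniteFieldNotions.Nstar F FF n a))
theorem3p5 p s n _ _ _ _ F FF a a≉0 =
  (λ { (inj₁ p≡1)            → formula-1mod4 (pow-1mod4 p≡1 s) n a a≉0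
     ; (inj₂ (p≡3 , s-even)) → formula-1mod4 (pow-3mod4-even p≡3 s s-even) n a a≉0 }) ,
  (λ { (p≡3 , s-odd)         → formula-3mod4 (pow-3mod4-odd p≡3 s s-odd) n a a≉0 })
  where open FormulaByResidue F FF
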